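{- Let $(\mathbf{H},\varphi)$ be a linearized combinatorial Hopf monoid, let $N$ be a finite set, $\mathbf{h}\in\mathbf{H}[N]$, and $\mathfrak{G}\subseteq\mathrm{Aut}(\mathbf{h})$. Then: \begin{enumerate} \item for every $\mathfrak{g}\in\mathfrak{G}$, $\Psi_{\mathbf{H},\varphi}(\mathbf{h},\mathfrak{G},\mathbf{x};\mathfrak{g})=\sum_{C\in\mathcal{C}_\varphi(\mathbf{h}):\ \mathfrak{g}C=C} M_{\alpha(C)}$; \item $\Psi_{\mathbf{H},\varphi}(\mathbf{h},\mathfrak{G},\mathbf{x})=\sum_{\alpha\models|N|}\Psi_{\mathbf{h},\alpha}M_\alpha$; \item $\Psi_{\mathbf{H},\varphi}(\mathbf{h},\mathfrak{G},x)=\sum_{\alpha\models|N|}\Psi_{\mathbf{h},\alpha}\binom{x}{\ell(\alpha)}$. \end{enumerate}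
   Context: $\mathbb{N}=\{0,1,2,\dots\}$, $[x]=\{1,\dots,x\}$, $\mathbf{x}=x_1,x_2,\dots$ commuting indeterminates. A set species $\mathbf{H}$ assigns to each finite set $N$ a finite set $\mathbf{H}[N]$ and to each bijection $\sigma:M\to N$ a bijection $\mathbf{H}[\sigma]:\mathbf{H}[M]\to\mathbf{H}[N]$, functorially. A linearized Hopf monoid is a set species with $|\mathbf{H}[\emptyset]|=1$ together with, for all disjoint finite $M,N$, maps $\mu_{M,N}:\mathbf{H}[M]\times\mathbf{H}[N]\to\mathbf{H}[M\sqcup N]$, $(x,y)\mapsto x\cdot y$, and $\Delta_{M,N}:\mathbf{H}[M\sqcup N]\to(\mathbf{H}[M]\times\mathbf{H}[N])\sqcup\{0\}$, writing $\Delta_{M,N}(\mathbf{h})=(\mathbf{h}|_M,\mathbf{h}/M)$ when nonzero, such that their linear extensions make the linearization (the linear species with $N\mapsto$ the vector space with basis $\mathbf{H}[N]$) a connected Hopf monoid in linear species. A linearized character is a family of maps $\varphi_N:\mathbf{H}[N]\to\{0,1\}$, natural with respect to bijections, with $\varphi(x\cdot y)=\varphi(x)\varphi(y)$; the pair $(\mathbf{H},\varphi)$ is a linearized combinatorial Hopf monoid. A set composition $C=C_1|\cdots|C_k\models N$ is a sequence of disjoint nonempty sets with union $N$; $\ell(C)=k$, type $\alpha(C)=(|C_1|,\dots,|C_k|)$. Define $\Delta_C(\mathbf{h})$ iteratively: for $k=1$ it is $\mathbf{h}$; otherwise it is $0$ if $\Delta_{C_1,N\setminus C_1}(\mathbf{h})=0$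 and else $(\mathbf{h}|_{C_1},\Delta_{C_2|\cdots|C_k}(\mathbf{h}/C_1))$. Set $\varphi_C(\mathbf{h})=\prod_i\varphi(\mathbf{h}_i)$ if $\Delta_C(\mathbf{h})=(\mathbf{h}_1,\dots,\mathbf{h}_k)$ and $\varphi_C(\mathbf{h})=0$ if it is $0$. $C$ is $\varphi$-proper if $\varphi_C(\mathbf{h})=1$; $\mathcal{C}_\varphi(\mathbf{h})$ is the set of $\varphi$-proper set compositions and $\mathcal{C}_{\mathbf{h},\alpha}$ those of type $\alpha$. For $f:N\to\mathbb{N}$ with values $i_1<\dots<i_k$, $C(f)=f^{ -1}(i_1)|\cdots|f^{ -1}(i_k)$, and $f$ is a $\varphi$-proper coloring of $\mathbf{h}$ iff $\varphi_{C(f)}(\mathbf{h})=1$; $F_\varphi(\mathbf{h})$ is the set of these. $\mathfrak{S}_N$ acts on $\mathbf{H}[N]$ by $\mathfrak{g}\cdot\mathbf{h}=\mathbf{H}[\mathfrak{g}](\mathbf{h})$, $\mathrm{Aut}(\mathbf{h})$ is the stabilizer of $\mathbf{h}$; $\mathfrak{g}$ acts on colorings by $\mathfrak{g}f=f\circ\mathfrak{g}^{ -1}$ and on set compositions by $\mathfrak{g}C=\mathfrak{g}(C_1)|\cdots|\mathfrak{g}(C_k)$. For $\mathfrak{g}\in\mathfrak{G}$: $\Psi_{\mathbf{H},\varphi}(\mathbf{h},\mathfrak{G},\mathbf{x};\mathfrak{g})=\sum_{f\in F_\varphi(\mathbf{h}),\ \mathfrak{g}f=f}\prod_{v\in N}x_{f(v)}$,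 and $\Psi_{\mathbf{H},\varphi}(\mathbf{h},\mathfrak{G},x;\mathfrak{g})$ is the number of $f\in F_\varphi(\mathbf{h})$ with $\mathfrak{g}f=f$ and $f(N)\subseteq[x]$. $M_\alpha=\sum_{i_1<\cdots<i_k}\prod_jx_{i_j}^{\alpha_j}$ is the monomial quasisymmetric function, $\ell(\alpha)$ the number of parts of $\alpha$. $\mathfrak{G}$ acts on $\mathcal{C}_{\mathbf{h},\alpha}$, and $\Psi_{\mathbf{h},\alpha}$ denotes the resulting permutation character, $\Psi_{\mathbf{h},\alpha}(\mathfrak{g})=|\{C\in\mathcal{C}_{\mathbf{h},\alpha}:\mathfrak{g}C=C\}|$. Identities 2 and 3 are equalities of functions of $\mathfrak{g}\in\mathfrak{G}$. -}

module Defs where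

open import Level using (0ℓ)
open import Data.Nat using (ℕ; zero; suc; _+_; _*_)
open import Data.Nat.ListAction using (sum)
open import Data.Bool using (Bool; true; false; T; not; _∧_; if_then_else_)
open import Data.Bool.Properties using () renaming (_≟_ to _≟B_)
open import Data.Unit using (⊤; tt)
open import Data.Empty using (⊥)
open import Data.Fin using (Fin; toℕ) renaming (zero to fzero; suc to fsuc)
open import Data.Fin.Properties using (all?; any?) renaming (_≟_ to _≟F_)
open import Data.Nat.Properties using () renaming (_≟_ to _≟N_)
open import Data.List using (List; []; _∷_; map; length; filter; allFin; upTo; lookup; concatMap; _++_)
open import Data.List.Properties using (≡-dec)
open import Data.Maybe using (Maybe; just; nothing; _>>=_)
import Data.Maybe
open import Data.Product using (Σ; ∃; _×_; _,_; proj₁; proj₂)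
open import Data.Product using () renaming (map to ×map)
open import Data.Sum using (_⊎_; inj₁; inj₂; [_,_])
open import Data.Sum.Function.Propositional using (_⊎-↔_)
open import Function using (_∘_)
open import Function.Bundles using (_↔_; Inverse; mk↔ₛ′)
open import Function.Construct.Identity using (↔-id)
open import Function.Construct.Composition using (_↔-∘_)
open import Function.Construct.Symmetry using (↔-sym)
open import Relation.Binary.PropositionalEquality using (_≡_; refl; sym; subst; cong)
open import Relation.Nullary using (Dec; yes; no; ¬_; ¬?)
open import Relation.Nullary.Decidable using (⌊_⌋; _×-dec_)

module _ {A B C : Set} where
  assoc⊎ : ((A ⊎ B) ⊎ C) ↔ (A ⊎ (B ⊎ C))
  assoc⊎ = mk↔ₛ′ to from tf ft
    where
    to : (A ⊎ B) ⊎ C → A ⊎ (B ⊎ C)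
    to (inj₁ (inj₁ a)) = inj₁ a
    to (inj₁ (inj₂ b)) = inj₂ (inj₁ b)
    to (inj₂ c) = inj₂ (inj₂ c)
    from : A ⊎ (B ⊎ C) → (A ⊎ B) ⊎ C
    from (inj₁ a) = inj₁ (inj₁ a)
    from (inj₂ (inj₁ b)) = inj₁ (inj₂ b)
    from (inj₂ (inj₂ c)) = inj₂ c
    tf : ∀ y → to (from y) ≡ y
    tf (inj₁ a) = refl
    tf (inj₂ (inj₁ b)) = refl
    tf (inj₂ (inj₂ c)) = refl
    ft : ∀ x → from (to x) ≡ x
    ft (inj₁ (inj₁ a)) = refl
    ft (inj₁ (inj₂ b)) = refl
    ft (inj₂ c) = refl

module _ {A B C D : Set} where
  midSwap : ((A ⊎ B) ⊎ (C ⊎ D)) ↔ ((A ⊎ C) ⊎ (B ⊎ D))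
  midSwap = mk↔ₛ′ sw sw inv inv
    where
    sw : ∀ {W X Y Z : Set} → (W ⊎ X) ⊎ (Y ⊎ Z) → (W ⊎ Y) ⊎ (X ⊎ Z)
    sw (inj₁ (inj₁ a)) = inj₁ (inj₁ a)
    sw (inj₁ (inj₂ b)) = inj₂ (inj₁ b)
    sw (inj₂ (inj₁ c)) = inj₁ (inj₂ c)
    sw (inj₂ (inj₂ d)) = inj₂ (inj₂ d)
    inv : ∀ {W X Y Z : Set} (x : (W ⊎ X) ⊎ (Y ⊎ Z)) → sw (sw x) ≡ x
    inv (inj₁ (inj₁ a)) = refl
    inv (inj₁ (inj₂ b)) = refl
    inv (inj₂ (inj₁ c)) = refl
    inv (inj₂ (inj₂ d)) = refl

module _ {A : Set} where
  unitˡ : A ↔ (⊥ ⊎ A)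
  unitˡ = mk↔ₛ′ inj₂ [ (λ ()) , (λ a → a) ] tf (λ _ → refl)
    where
    tf : ∀ y → inj₂ ([ (λ ()) , (λ a → a) ] y) ≡ y
    tf (inj₂ a) = refl
    tf (inj₁ ())

  unitʳ : A ↔ (A ⊎ ⊥)
  unitʳ = mk↔ₛ′ inj₁ [ (λ a → a) , (λ ()) ] tf (λ _ → refl)
    where
    tf : ∀ y → inj₁ ([ (λ a → a) , (λ ()) ] y) ≡ y
    tf (inj₁ a) = refl
    tf (inj₂ ())

Sub : (A : Set) → (A → Bool) → Set
Sub A P = Σ A (λ a → T (P a))

Compl : (A : Set) → (A → Bool) → Set
Compl A P = Σ A (λ a → T (not (P a)))

T-irr : ∀ b (p q : T b) → p ≡ q
T-irr true tt tt = refl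

module _ {A : Set} (P : A → Bool) where
  private
    aux : (a : A) (b : Bool) → P a ≡ b → Sub A P ⊎ Compl A P
    aux a true e = inj₁ (a , subst T (sym e) tt)
    aux a false e = inj₂ (a , subst (λ b → T (not b)) (sym e) tt)

    to : A → Sub A P ⊎ Compl A P
    to a = aux a (P a) refl

    from : Sub A P ⊎ Compl A P → A
    from = [ proj₁ , proj₁ ]

    ft-aux : ∀ a b (e : P a ≡ b) → from (aux a b e) ≡ a
    ft-aux a true e = refl
    ft-aux a false e = refl

    tf₁ : ∀ a (p : T (P a)) b (e : P a ≡ b) → aux a b e ≡ inj₁ (a , p)
    tf₁ a p true e = cong (λ q → inj₁ (a , q)) (T-irr (P a) _ p)
    tf₁ a p false e with subst T e p
    ... | ()

    tf₂ : ∀ a (p : T (not (P a))) b (e : P a ≡ b) → aux a b e ≡ inj₂ (a , p)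
    tf₂ a p true e with subst (λ b → T (not b)) e p
    ... | ()
    tf₂ a p false e = cong (λ q → inj₂ (a , q)) (T-irr (not (P a)) _ p)

    tf : ∀ y → to (from y) ≡ y
    tf (inj₁ (a , p)) = tf₁ a p (P a) refl
    tf (inj₂ (a , p)) = tf₂ a p (P a) refl

  split : A ↔ (Sub A P ⊎ Compl A P)
  split = mk↔ₛ′ to from tf (λ a → ft-aux a (P a) refl)

-- A set species is modelled as a functor H from the groupoid of (finite)
-- types and bijections ( _↔_ ) to types; disjoint union is _⊎_ and the
-- empty set is ⊥.  Products μ and coproducts Δ are set maps, Δ taking
-- the value nothing for "0".  The fields below are exactly the axioms
-- making the linearization a connected Hopf monoid in linear species
-- (a connected bimonoid automatically has an antipode).

record LinHopfMonoid : Set₁ where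
  field
    H      : Set → Set
    mapH   : ∀ {A B : Set} → A ↔ B → H A → H B
    mapH-id   : ∀ {A : Set} (x : H A) → mapH (↔-id A) x ≡ x
    mapH-∘    : ∀ {A B C : Set} (σ : A ↔ B) (τ : B ↔ C) (x : H A) →
                mapH (τ ↔-∘ σ) x ≡ mapH τ (mapH σ x)
    mapH-cong : ∀ {A B : Set} (σ τ : A ↔ B) →
                (∀ a → Inverse.to σ a ≡ Inverse.to τ a) →
                ∀ (x : H A) → mapH σ x ≡ mapH τ x
    finite : ∀ n → ∃ λ m → H (Fin n) ↔ Fin m
    e      : H ⊥
    e-uniq : ∀ (x : H ⊥) → x ≡ e
    μ      : ∀ {A B : Set} → H A → H B → H (A ⊎ B)
    Δ      : ∀ {A B : Set} → H (A ⊎ B) → Maybe (H A × H B)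
    μ-nat  : ∀ {A A' B B' : Set} (σ : A ↔ A') (τ : B ↔ B') (x : H A) (y : H B) →
             mapH (σ ⊎-↔ τ) (μ x y) ≡ μ (mapH σ x) (mapH τ y)
    Δ-nat  : ∀ {A A' B B' : Set} (σ : A ↔ A') (τ : B ↔ B') (z : H (A ⊎ B)) →
             Δ (mapH (σ ⊎-↔ τ) z) ≡ Data.Maybe.map (×map (mapH σ) (mapH τ)) (Δ z)
    μ-assoc : ∀ {A B C : Set} (x : H A) (y : H B) (z : H C) →
              mapH assoc⊎ (μ (μ x y) z) ≡ μ x (μ y z)
    μ-unitˡ : ∀ {A : Set} (x : H A) → μ e x ≡ mapH (unitˡ {A = A}) x
    μ-unitʳ : ∀ {A : Set} (x : H A) → μ x e ≡ mapH (unitʳ {A = A}) x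
    Δ-coassoc : ∀ {A B C : Set} (z : H ((A ⊎ B) ⊎ C)) →
      (Δ z >>= λ uw → Δ (proj₁ uw) >>= λ xy → just (proj₁ xy , proj₂ xy , proj₂ uw))
      ≡ (Δ (mapH assoc⊎ z) >>= λ xv → Δ (proj₂ xv) >>= λ yw → just (proj₁ xv , proj₁ yw , proj₂ yw))
    Δ-counitˡ : ∀ {A : Set} (x : H A) → Δ (mapH (unitˡ {A = A}) x) ≡ just (e , x)
    Δ-counitʳ : ∀ {A : Set} (x : H A) → Δ (mapH (unitʳ {A = A}) x) ≡ just (x , e)
    -- compatibility (bimonoid axiom): for I = M ⊔ N = P ⊔ Q with
    -- M = A ⊔ B, N = C ⊔ D, P = A ⊔ C, Q = B ⊔ D
    compat : ∀ {A B C D : Set} (x : H (A ⊎ B)) (y : H (C ⊎ D)) →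
      Δ (mapH midSwap (μ x y))
      ≡ (Δ x >>= λ x₁₂ → Δ y >>= λ y₁₂ →
           just (μ (proj₁ x₁₂) (proj₁ y₁₂) , μ (proj₂ x₁₂) (proj₂ y₁₂)))

record LinCharacter (HM : LinHopfMonoid) : Set₁ where
  open LinHopfMonoid HM
  field
    φ      : ∀ {A : Set} → H A → Bool
    φ-nat  : ∀ {A B : Set} (σ : A ↔ B) (x : H A) → φ (mapH σ x) ≡ φ x
    φ-mult : ∀ {A B : Set} (x : H A) (y : H B) → φ (μ x y) ≡ φ x ∧ φ y

Perm : ℕ → Set
Perm n = Fin n ↔ Fin n

module _ (HM : LinHopfMonoid) where
  open LinHopfMonoid HM

  InAut : ∀ {n} → H (Fin n) → Perm n → Set
  InAut h g = mapH g h ≡ h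

record IsSubgroup {n : ℕ} (G : Perm n → Set) : Set where
  field
    has-id  : G (↔-id (Fin n))
    has-∘   : ∀ g g' → G g → G g' → G (g ↔-∘ g')
    has-inv : ∀ g → G g → G (↔-sym g)

-- φ_C(𝐡) for a set composition C = C₁|⋯|C_k of a type A, the blocks
-- being given by Boolean predicates  B i : A → Bool  (i : Fin k).

module _ (HM : LinHopfMonoid) (χ : LinCharacter HM) where
  open LinHopfMonoid HM
  open LinCharacter χ

  phiC : ∀ {A : Set} (k : ℕ) → (Fin k → A → Bool) → H A → Bool
  phiC zero B x = true
  phiC (suc zero) B x = φ x
  phiC {A} (suc (suc k)) B x =
    Data.Maybe.maybe
      (λ p → φ (proj₁ p) ∧ phiC (suc k) (λ i a → B (fsuc i) (proj₁ a)) (proj₂ p))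
      false
      (Δ (mapH (split (B fzero)) x))

allFuns : ∀ n m → List (Fin n → Fin m)
allFuns zero m = (λ ()) ∷ []
allFuns (suc n) m =
  concatMap (λ i → map (λ f → λ { fzero → i ; (fsuc v) → f v }) (allFuns n m)) (allFin m)

count : ∀ {X : Set} {P : X → Set} → (∀ x → Dec (P x)) → List X → ℕ
count P? xs = length (filter P? xs)

compositions : ℕ → List (List ℕ)
compositions zero = [] ∷ []
compositions (suc n) = map (1 ∷_) (compositions n) ++ concatMap bump (compositions n)
  where
  bump : List ℕ → List (List ℕ)
  bump [] = []
  bump (a ∷ as) = (suc a ∷ as) ∷ []

-- coefficient of x^β in the monomial quasisymmetric function M_α, where
-- a monomial x^β = ∏ x_i^{β_i} is given by its exponent list β
-- (β_i = 0 beyond the end of the list): it is 1 if the nonzero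
-- exponents of β, read in increasing order of i, are α, and 0 otherwise.
Mcoeff : List ℕ → List ℕ → ℕ
Mcoeff α β with ≡-dec _≟N_ (filter (λ b → ¬? (b ≟N 0)) β) α
... | yes _ = 1
... | no  _ = 0

-- A set composition C₁|⋯|C_k ⊨ Fin n is represented by the map
-- c : Fin n → Fin k sending v to the index of its block (C_i = c⁻¹(i)),
-- required to be surjective (blocks nonempty).

IsSetComp : ∀ {n k} → (Fin n → Fin k) → Set
IsSetComp {n} {k} c = ∀ (i : Fin k) → ∃ λ (v : Fin n) → c v ≡ i

isSetComp? : ∀ {n k} (c : Fin n → Fin k) → Dec (IsSetComp c)
isSetComp? c = all? (λ i → any? (λ v → c v ≟F i))

blocksOf : ∀ {n k} → (Fin n → Fin k) → Fin k → Fin n → Bool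
blocksOf c i v = ⌊ c v ≟F i ⌋

typeOf : ∀ {n k} → (Fin n → Fin k) → List ℕ
typeOf {n} {k} c = map (λ i → count (λ v → c v ≟F i) (allFin n)) (allFin k)

-- 𝔤C = C   (𝔤C has blocks 𝔤(C_i), i.e. index map c ∘ 𝔤⁻¹)
FixedC : ∀ {n k} → Perm n → (Fin n → Fin k) → Set
FixedC {n} g c = ∀ v → c (Inverse.from g v) ≡ c v

fixedC? : ∀ {n k} (g : Perm n) (c : Fin n → Fin k) → Dec (FixedC g c)
fixedC? g c = all? (λ v → c (Inverse.from g v) ≟F c v)

-- 𝔤f = f for a coloring f : N → ℕ   (𝔤f = f ∘ 𝔤⁻¹)
FixedF : ∀ {n} → Perm n → (Fin n → ℕ) → Set
FixedF {n} g f = ∀ v → f (Inverse.from g v) ≡ f v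

fixedF? : ∀ {n} (g : Perm n) (f : Fin n → ℕ) → Dec (FixedF g f)
fixedF? g f = all? (λ v → f (Inverse.from g v) ≟N f v)

-- the set composition C(f) = f⁻¹(i₁)|⋯|f⁻¹(i_k) of a coloring f,
-- i₁ < ⋯ < i_k the values of f (all values are ≤ Σ_v f v)
valuesOf : ∀ {n} → (Fin n → ℕ) → List ℕ
valuesOf {n} f = filter (λ j → any? (λ v → f v ≟N j)) (upTo (suc (sum (map f (allFin n)))))

blocksOfColoring : ∀ {n} (f : Fin n → ℕ) → Fin (length (valuesOf f)) → Fin n → Bool
blocksOfColoring f i v = ⌊ f v ≟N lookup (valuesOf f) i ⌋

module _ (HM : LinHopfMonoid) (χ : LinCharacter HM) {n : ℕ}
         (h : LinHopfMonoid.H HM (Fin n)) where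

  ProperC : ∀ {k} → (Fin n → Fin k) → Set
  ProperC {k} c = phiC HM χ k (blocksOf c) h ≡ true

  ProperColoring : (Fin n → ℕ) → Set
  ProperColoring f = phiC HM χ (length (valuesOf f)) (blocksOfColoring f) h ≡ true

  properC? : ∀ {k} (c : Fin n → Fin k) → Dec (ProperC c)
  properC? {k} c = phiC HM χ k (blocksOf c) h ≟B true

  properColoring? : (f : Fin n → ℕ) → Dec (ProperColoring f)
  properColoring? f = phiC HM χ (length (valuesOf f)) (blocksOfColoring f) h ≟B true

  ProperFixedC : ∀ {k} → Perm n → (Fin n → Fin k) → Set
  ProperFixedC g c = IsSetComp c × ProperC c × FixedC g c

  properFixedC? : ∀ {k} (g : Perm n) (c : Fin n → Fin k) → Dec (ProperFixedC g c)
  properFixedC? g c = isSetComp? c ×-dec (properC? c ×-dec fixedC? g c)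

  PsiAlpha : Perm n → List ℕ → ℕ
  PsiAlpha g α =
    count (λ c → properFixedC? g c ×-dec ≡-dec _≟N_ (typeOf c) α) (allFuns n (length α))

  -- coefficient of x^β in Ψ_{𝐇,φ}(𝐡,𝔊,𝐱;𝔤) = Σ_{f ∈ F_φ(𝐡), 𝔤f = f} ∏_v x_{f(v)}:
  -- the number of φ-proper colorings f : N → ℕ with 𝔤f = f and
  -- |f⁻¹(i)| = β_i for all i ∈ ℕ (such f take values < length β).
  PsiCoeff : Perm n → List ℕ → ℕ
  PsiCoeff g β =
    count (λ f → (properColoring? (toℕ ∘ f) ×-dec fixedF? g (toℕ ∘ f))
                 ×-dec all? (λ i → count (λ v → f v ≟F i) (allFin n) ≟N lookup β i))
          (allFuns n (length β))

  -- coefficient of x^β in Σ_{C ∈ 𝒞_φ(𝐡), 𝔤C = C} M_{α(C)}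
  -- (every set composition of Fin n has k ≤ n blocks)
  FixedCompSumCoeff : Perm n → List ℕ → ℕ
  FixedCompSumCoeff g β =
    sum (map (λ k → sum (map (λ c → Mcoeff (typeOf c) β)
                             (filter (properFixedC? g) (allFuns n (toℕ k)))))
             (allFin (suc n)))

  -- Ψ_{𝐇,φ}(𝐡,𝔊,x;𝔤): number of φ-proper f with 𝔤f = f and f(N) ⊆ [x]
  -- (f is encoded by f' : N → Fin x with f(v) = 1 + f'(v))
  PsiCount : Perm n → ℕ → ℕ
  PsiCount g x =
    count (λ f → properColoring? (λ v → suc (toℕ (f v)))
                 ×-dec fixedF? g (λ v → suc (toℕ (f v)))) (allFuns n x)

{-# OPTIONS --safe #-}
-- A coloring f : N → ℕ is the block map c of its set composition C(f) followed by the
-- increasing map sending the i-th block to the i-th smallest value of f, and this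
-- factorisation is unique. Properness of f depends only on C(f), and 𝔤f = f iff 𝔤C(f) = C(f)
-- because the increasing part is injective. Hence a sum over fixed proper colorings is a sum
-- over fixed proper set compositions C and increasing maps on the blocks of C: into [x] there
-- are binomial(x, ℓ(C)) of these, and exactly one or none gives the monomial x^β, according to whether
-- the nonzero entries of β are α(C), which is the coefficient of x^β in M_α(C). Grouping the
-- set compositions by type gives the other two identities. The argument works for every
-- permutation 𝔤.
module Submission where

open import Defs
open import Data.Nat using (ℕ; zero; suc; _+_; _*_; _∸_; _≤_; _<_; z≤n; s≤s; s≤s⁻¹; _≤?_; _<?_)
open import Data.Nat.Properties
open import Algebra.Properties.CommutativeSemigroup +-commutativeSemigroup using (interchange)
open import Algebra.Properties.CommutativeSemigroup *-commutativeSemigroup using (x∙yz≈y∙xz)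
open import Data.Nat.ListAction using (sum)
open import Data.Nat.ListAction.Properties using (sum-++)
open import Data.Nat.Combinatorics using (_C_; nCk+nC[k+1]≡[n+1]C[k+1])
open import Data.Fin using (Fin; toℕ; cast; fromℕ<) renaming (zero to fzero; suc to fsuc; _<_ to _<ᶠ_)
import Data.Fin.Properties as Fin
open import Data.List using (List; []; _∷_; map; length; filter; allFin; concatMap; _++_; lookup; upTo)
import Data.List.Properties as List
open import Data.List.Relation.Unary.All as All using (All; _∷_)
open import Data.List.Relation.Unary.AllPairs using (AllPairs; _∷_)
import Data.List.Relation.Unary.AllPairs.Properties as AllPairs
open import Data.List.Relation.Unary.Any as Any using (here; there)
open import Data.List.Relation.Unary.Any.Properties using (lookup-index)
open import Data.List.Membership.Propositional using (_∈_)
open import Data.List.Membership.Propositional.Properties using (∈-lookup; ∈-allFin; ∈-map⁺; ∈-map⁻; ∈-filter⁺; ∈-filter⁻; ∈-upTo⁺)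
open import Data.List.Relation.Binary.Subset.Propositional using (_⊆_)
open import Data.Product using (Σ; ∃; _×_; _,_; proj₁; proj₂) renaming (map to ×-map)
open import Data.Sum using (inj₁; inj₂)
open import Data.Sum.Function.Propositional using (_⊎-↔_)
open import Data.Bool using (Bool; false; T; not; _∧_)
open import Data.Maybe as Maybe using (just; nothing; maybe′)
open import Function.Bundles using (_↔_; Inverse; Injection; mk↔ₛ′)
open import Function.Properties.Inverse using (↔⇒↣)
open import Function.Construct.Identity using (↔-id)
open import Function.Construct.Composition using (_↔-∘_)
open import Function.Construct.Symmetry using (↔-sym)
open import Function using (_∘_; id; _⇔_; mk⇔; Equivalence)
open import Relation.Binary.PropositionalEquality
open import Relation.Nullary using (Dec; yes; no; ¬_; ¬?)
open import Relation.Nullary.Decidable using (⌊_⌋; _×-dec_; _→-dec_; map′)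
open import Relation.Binary using (_Preserves_⟶_; tri<; tri≈; tri>)
open import Data.Empty using (⊥-elim)

∑ : {A : Set} → List A → (A → ℕ) → ℕ
∑ xs f = sum (map f xs)

syntax ∑ xs (λ x → e) = ∑[ x ∈ xs ] e

𝟙 : {P : Set} → Dec P → ℕ
𝟙 (yes _) = 1
𝟙 (no _) = 0

𝟙-yes : {P : Set} (p : Dec P) → P → 𝟙 p ≡ 1
𝟙-yes (yes _) _ = refl
𝟙-yes (no ¬p) p = ⊥-elim (¬p p)

𝟙-no : {P : Set} (p : Dec P) → ¬ P → 𝟙 p ≡ 0
𝟙-no (yes p) ¬p = ⊥-elim (¬p p)
𝟙-no (no _) _ = refl

𝟙-× : {P Q : Set} (p : Dec P) (q : Dec Q) → 𝟙 (p ×-dec q) ≡ 𝟙 p * 𝟙 q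
𝟙-× (yes _) (yes _) = refl
𝟙-× (yes _) (no _) = refl
𝟙-× (no _) _ = refl

𝟙-⇔ : {P Q : Set} (p : Dec P) (q : Dec Q) → (P → Q) → (Q → P) → 𝟙 p ≡ 𝟙 q
𝟙-⇔ (yes _) (yes _) _ _ = refl
𝟙-⇔ (yes p) (no ¬q) P→Q _ = ⊥-elim (¬q (P→Q p))
𝟙-⇔ (no ¬p) (yes q) _ Q→P = ⊥-elim (¬p (Q→P q))
𝟙-⇔ (no _) (no _) _ _ = refl

𝟙-*-cong : {P : Set} (p : Dec P) {x y : ℕ} → (P → x ≡ y) → 𝟙 p * x ≡ 𝟙 p * y
𝟙-*-cong (yes p) x≡y = cong (_+ 0) (x≡y p)
𝟙-*-cong (no _) _ = refl

⌊⌋-⇔ : {P Q : Set} (p : Dec P) (q : Dec Q) → (P → Q) → (Q → P) → ⌊ p ⌋ ≡ ⌊ q ⌋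
⌊⌋-⇔ (yes _) (yes _) _ _ = refl
⌊⌋-⇔ (yes p) (no ¬q) P→Q _ = ⊥-elim (¬q (P→Q p))
⌊⌋-⇔ (no ¬p) (yes q) _ Q→P = ⊥-elim (¬p (Q→P q))
⌊⌋-⇔ (no _) (no _) _ _ = refl

module _ {A : Set} where

  ∑-cong : {f g : A → ℕ} (xs : List A) → (∀ x → f x ≡ g x) → ∑ xs f ≡ ∑ xs g
  ∑-cong xs f≗g = cong sum (List.map-cong f≗g xs)

  ∑-zero : (xs : List A) (f : A → ℕ) → (∀ x → f x ≡ 0) → ∑ xs f ≡ 0
  ∑-zero [] f f≗0 = refl
  ∑-zero (x ∷ xs) f f≗0 rewrite f≗0 x = ∑-zero xs f f≗0

  ∑-++ : (xs ys : List A) (f : A → ℕ) → ∑ (xs ++ ys) f ≡ ∑ xs f + ∑ ys f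
  ∑-++ xs ys f = trans (cong sum (List.map-++ f xs ys)) (sum-++ (map f xs) (map f ys))

  ∑-+ : (xs : List A) (f g : A → ℕ) → ∑[ x ∈ xs ] (f x + g x) ≡ ∑ xs f + ∑ xs g
  ∑-+ [] f g = refl
  ∑-+ (x ∷ xs) f g rewrite ∑-+ xs f g = interchange (f x) (g x) (∑ xs f) (∑ xs g)

  ∑-*ˡ : (a : ℕ) (xs : List A) (f : A → ℕ) → ∑[ x ∈ xs ] (a * f x) ≡ a * ∑ xs f
  ∑-*ˡ a [] f = sym (*-zeroʳ a)
  ∑-*ˡ a (x ∷ xs) f = trans (cong (a * f x +_) (∑-*ˡ a xs f)) (sym (*-distribˡ-+ a (f x) _))

  ∑-*ʳ : (a : ℕ) (xs : List A) (f : A → ℕ) → ∑[ x ∈ xs ] (f x * a) ≡ ∑ xs f * a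
  ∑-*ʳ a xs f = trans (∑-cong xs (λ x → *-comm (f x) a)) (trans (∑-*ˡ a xs f) (*-comm a _))

  ∑-const-1 : (xs : List A) → ∑[ x ∈ xs ] 1 ≡ length xs
  ∑-const-1 [] = refl
  ∑-const-1 (x ∷ xs) = cong suc (∑-const-1 xs)

  count≡∑𝟙 : {P : A → Set} (P? : ∀ x → Dec (P x)) (xs : List A) → count P? xs ≡ ∑[ x ∈ xs ] 𝟙 (P? x)
  count≡∑𝟙 P? [] = refl
  count≡∑𝟙 P? (x ∷ xs) with P? x
  ... | yes _ = cong suc (count≡∑𝟙 P? xs)
  ... | no _ = count≡∑𝟙 P? xs

  ∑-cong-∈ : {f g : A → ℕ} (xs : List A) → (∀ x → x ∈ xs → f x ≡ g x) → ∑ xs f ≡ ∑ xs g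
  ∑-cong-∈ [] f≗g = refl
  ∑-cong-∈ (x ∷ xs) f≗g = cong₂ _+_ (f≗g x (here refl)) (∑-cong-∈ xs (λ y y∈xs → f≗g y (there y∈xs)))

  ∑-filter : {P : A → Set} (P? : ∀ x → Dec (P x)) (xs : List A) (f : A → ℕ) →
             ∑ (filter P? xs) f ≡ ∑[ x ∈ xs ] (𝟙 (P? x) * f x)
  ∑-filter P? [] f = refl
  ∑-filter P? (x ∷ xs) f with P? x
  ... | yes _ = cong₂ _+_ (sym (+-identityʳ (f x))) (∑-filter P? xs f)
  ... | no _ = ∑-filter P? xs f

module _ {A B : Set} where

  ∑-map : (g : A → B) (xs : List A) (f : B → ℕ) → ∑ (map g xs) f ≡ ∑ xs (f ∘ g)
  ∑-map g xs f = cong sum (sym (List.map-∘ xs))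

  ∑-concatMap : (g : A → List B) (xs : List A) (f : B → ℕ) →
                ∑ (concatMap g xs) f ≡ ∑[ x ∈ xs ] ∑ (g x) f
  ∑-concatMap g [] f = refl
  ∑-concatMap g (x ∷ xs) f = trans (∑-++ (g x) (concatMap g xs) f) (cong (∑ (g x) f +_) (∑-concatMap g xs f))

  ∑-swap : (xs : List A) (ys : List B) (F : A → B → ℕ) →
           ∑[ x ∈ xs ] ∑[ y ∈ ys ] F x y ≡ ∑[ y ∈ ys ] ∑[ x ∈ xs ] F x y
  ∑-swap [] ys F = sym (∑-zero ys _ (λ _ → refl))
  ∑-swap (x ∷ xs) ys F = trans (cong (∑ ys (F x) +_) (∑-swap xs ys F))
    (sym (∑-+ ys (F x) (λ y → ∑[ x ∈ xs ] F x y)))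

∑-*-swap : {A B : Set} (xs : List A) (ys : List B) (G : A → B → ℕ) (F : B → ℕ) →
           ∑[ y ∈ ys ] ((∑[ x ∈ xs ] G x y) * F y) ≡ ∑[ x ∈ xs ] ∑[ y ∈ ys ] (G x y * F y)
∑-*-swap xs ys G F = trans (∑-cong ys (λ y → sym (∑-*ʳ (F y) xs (λ x → G x y)))) (∑-swap ys xs _)

∑-*-assoc : {B : Set} (a : ℕ) (ys : List B) (G F : B → ℕ) → ∑[ y ∈ ys ] (a * G y * F y) ≡ a * ∑[ y ∈ ys ] (G y * F y)
∑-*-assoc a ys G F = trans (∑-cong ys (λ y → *-assoc a (G y) (F y))) (∑-*ˡ a ys _)

count-cong : {A : Set} {P Q : A → Set} (P? : ∀ x → Dec (P x)) (Q? : ∀ x → Dec (Q x)) (xs : List A) →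
  (∀ x → P x → Q x) → (∀ x → Q x → P x) → count P? xs ≡ count Q? xs
count-cong P? Q? xs P⇒Q Q⇒P = trans (count≡∑𝟙 P? xs)
  (trans (∑-cong xs (λ x → 𝟙-⇔ (P? x) (Q? x) (P⇒Q x) (Q⇒P x))) (sym (count≡∑𝟙 Q? xs)))

count-none : {A : Set} {P : A → Set} (P? : ∀ x → Dec (P x)) (xs : List A) → (∀ x → ¬ P x) → count P? xs ≡ 0
count-none P? xs ¬P = trans (count≡∑𝟙 P? xs) (∑-zero xs _ (λ x → 𝟙-no (P? x) (¬P x)))

count-∈ : {A : Set} {P : A → Set} (P? : ∀ x → Dec (P x)) {x : A} {xs : List A} → x ∈ xs → P x → 0 < count P? xs
count-∈ P? x∈xs Px = nonempty (∈-filter⁺ P? x∈xs Px)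
  where
  nonempty : ∀ {x} {ys : List _} → x ∈ ys → 0 < length ys
  nonempty {ys = _ ∷ _} _ = s≤s z≤n

_≗?_ : ∀ {n m} (f g : Fin n → Fin m) → Dec (f ≗ g)
f ≗? g = Fin.all? (λ v → f v Fin.≟ g v)

map-allFin-suc : {B : Set} (k : ℕ) (f : Fin (suc k) → B) → map f (allFin (suc k)) ≡ f fzero ∷ map (f ∘ fsuc) (allFin k)
map-allFin-suc k f = cong (f fzero ∷_) (trans (List.map-tabulate fsuc f) (sym (List.map-tabulate id (f ∘ fsuc))))

∑-allFin-suc : (k : ℕ) (f : Fin (suc k) → ℕ) → ∑ (allFin (suc k)) f ≡ f fzero + ∑ (allFin k) (f ∘ fsuc)
∑-allFin-suc k f = cong sum (map-allFin-suc k f)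

∑-allFin-δ : (k : ℕ) (j : Fin k) (f : Fin k → ℕ) → (∀ i → i ≢ j → f i ≡ 0) → ∑ (allFin k) f ≡ f j
∑-allFin-δ (suc k) fzero f f≡0 = begin
  ∑ (allFin (suc k)) f              ≡⟨ ∑-allFin-suc k f ⟩
  f fzero + ∑ (allFin k) (f ∘ fsuc) ≡⟨ cong (f fzero +_) (∑-zero (allFin k) (f ∘ fsuc) (λ i → f≡0 (fsuc i) (λ ()))) ⟩
  f fzero + 0                       ≡⟨ +-identityʳ _ ⟩
  f fzero                           ∎
  where open ≡-Reasoning
∑-allFin-δ (suc k) (fsuc j) f f≡0 = begin
  ∑ (allFin (suc k)) f              ≡⟨ ∑-allFin-suc k f ⟩
  f fzero + ∑ (allFin k) (f ∘ fsuc) ≡⟨ cong (_+ ∑ (allFin k) (f ∘ fsuc)) (f≡0 fzero (λ ())) ⟩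
  ∑ (allFin k) (f ∘ fsuc)           ≡⟨ ∑-allFin-δ k j (f ∘ fsuc) (λ i i≢j → f≡0 (fsuc i) (i≢j ∘ Fin.suc-injective)) ⟩
  f (fsuc j)                        ∎
  where open ≡-Reasoning

-- `F` need only be constant on the functions pointwise equal to `g`, as there is no function extensionality.
∑-allFuns-δ : ∀ n m (g : Fin n → Fin m) (F : (Fin n → Fin m) → ℕ) →
  (∀ f → ¬ (f ≗ g) → F f ≡ 0) → (∀ f → f ≗ g → F f ≡ F g) → ∑ (allFuns n m) F ≡ F g
∑-allFuns-δ zero m g F F≡0 F-resp = trans (+-identityʳ _) (F-resp _ (λ ()))
∑-allFuns-δ (suc n) m g F F≡0 F-resp =
  trans (∑-concatMap _ (allFin m) F)
  (trans (∑-cong (allFin m) (λ i → ∑-map _ (allFuns n m) F))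
  (trans (∑-allFin-δ m (g fzero) _ (λ i i≢g0 → ∑-zero (allFuns n m) _ (λ f → F≡0 _ (λ eq → i≢g0 (eq fzero)))))
  (trans (∑-allFuns-δ n m (g ∘ fsuc) _ (λ f f≉ → F≡0 _ (λ eq → f≉ (eq ∘ fsuc)))
           (λ f eq → trans (F-resp _ (λ { fzero → refl ; (fsuc v) → eq v }))
                           (sym (F-resp _ (λ { fzero → refl ; (fsuc v) → refl })))))
         (F-resp _ (λ { fzero → refl ; (fsuc v) → refl })))))

∑-allFuns-𝟙-unique : ∀ n m (g : Fin n → Fin m) {Q : (Fin n → Fin m) → Set} (Q? : ∀ f → Dec (Q f)) →
  (∀ f → Q f → f ≗ g) → (∀ f → f ≗ g → Q f) → ∑[ f ∈ allFuns n m ] 𝟙 (Q? f) ≡ 1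
∑-allFuns-𝟙-unique n m g Q? Q⇒≗ ≗⇒Q =
  trans (∑-allFuns-δ n m g _ (λ f f≉g → 𝟙-no (Q? f) (f≉g ∘ Q⇒≗ f))
                             (λ f f≗g → trans (𝟙-yes (Q? f) (≗⇒Q f f≗g)) (sym Qg≡1)))
        Qg≡1
  where
  Qg≡1 : 𝟙 (Q? g) ≡ 1
  Qg≡1 = 𝟙-yes (Q? g) (≗⇒Q g (λ _ → refl))

∑-allFuns-at : ∀ n m (g : Fin n → Fin m) (F : (Fin n → Fin m) → ℕ) (a : ℕ) → (∀ f → g ≗ f → F f ≡ a) →
  ∑[ f ∈ allFuns n m ] (𝟙 (g ≗? f) * F f) ≡ a
∑-allFuns-at n m g F a F≡a = begin
  ∑[ f ∈ allFuns n m ] (𝟙 (g ≗? f) * F f) ≡⟨ ∑-cong (allFuns n m) (λ f → 𝟙-*-cong (g ≗? f) (F≡a f)) ⟩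
  ∑[ f ∈ allFuns n m ] (𝟙 (g ≗? f) * a)   ≡⟨ ∑-*ʳ a (allFuns n m) _ ⟩
  ∑[ f ∈ allFuns n m ] 𝟙 (g ≗? f) * a     ≡⟨ cong (_* a) (∑-allFuns-𝟙-unique n m g (g ≗?_) (λ f g≗f → sym ∘ g≗f) (λ f f≗g → sym ∘ f≗g)) ⟩
  1 * a                                   ≡⟨ *-identityˡ a ⟩
  a                                       ∎
  where open ≡-Reasoning

Sorted : List ℕ → Set
Sorted = AllPairs _<_

Sorted-≡ : {xs ys : List ℕ} → Sorted xs → Sorted ys → xs ⊆ ys → ys ⊆ xs → xs ≡ ys
Sorted-≡ {[]} {[]} _ _ _ _ = refl
Sorted-≡ {[]} {y ∷ ys} _ _ _ ys⊆xs with () ← ys⊆xs {y} (here refl)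
Sorted-≡ {x ∷ xs} {[]} _ _ xs⊆ys _ with () ← xs⊆ys {x} (here refl)
Sorted-≡ {x ∷ xs} {y ∷ ys} (x< ∷ sx) (y< ∷ sy) xs⊆ys ys⊆xs = cong₂ _∷_ x≡y (Sorted-≡ sx sy xs⊆ys′ ys⊆xs′)
  where
  x≡y : x ≡ y
  x≡y with xs⊆ys {x} (here refl) | ys⊆xs {y} (here refl)
  ... | here x≡y | _ = x≡y
  ... | there _ | here y≡x = sym y≡x
  ... | there x∈ys | there y∈xs = ⊥-elim (<-asym (All.lookup y< x∈ys) (All.lookup x< y∈xs))
  xs⊆ys′ : xs ⊆ ys
  xs⊆ys′ {z} z∈xs with xs⊆ys (there z∈xs)
  ... | there z∈ys = z∈ys
  ... | here z≡y = ⊥-elim (<-irrefl (trans x≡y (sym z≡y)) (All.lookup x< z∈xs))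
  ys⊆xs′ : ys ⊆ xs
  ys⊆xs′ {z} z∈ys with ys⊆xs (there z∈ys)
  ... | there z∈xs = z∈xs
  ... | here z≡x = ⊥-elim (<-irrefl (trans (sym x≡y) (sym z≡x)) (All.lookup y< z∈ys))

AllPairs-lookup : {A : Set} {R : A → A → Set} {xs : List A} → AllPairs R xs →
  (i j : Fin (length xs)) → i <ᶠ j → R (lookup xs i) (lookup xs j)
AllPairs-lookup {xs = x ∷ xs} (x~ ∷ _) fzero (fsuc j) _ = All.lookup x~ (∈-lookup j)
AllPairs-lookup {xs = x ∷ xs} (_ ∷ pairs) (fsuc i) (fsuc j) (s≤s i<j) = AllPairs-lookup pairs i j i<j

filter-map : {A B : Set} {P : B → Set} (P? : ∀ b → Dec (P b)) (g : A → B) (xs : List A) →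
  filter P? (map g xs) ≡ map g (filter (P? ∘ g) xs)
filter-map P? g [] = refl
filter-map P? g (x ∷ xs) with P? (g x)
... | yes _ = cong (g x ∷_) (filter-map P? g xs)
... | no _ = filter-map P? g xs

lookup-cong : {A : Set} {xs ys : List A} → xs ≡ ys → (i : Fin (length xs)) (j : Fin (length ys)) →
  toℕ i ≡ toℕ j → lookup xs i ≡ lookup ys j
lookup-cong {xs = xs} refl i j i≡j = cong (lookup xs) (Fin.toℕ-injective i≡j)

map-lookup-allFin : {A : Set} (xs : List A) {k : ℕ} (k≡ : k ≡ length xs) → map (lookup xs ∘ cast k≡) (allFin k) ≡ xs
map-lookup-allFin xs refl = trans (List.map-cong (cong (lookup xs) ∘ Fin.cast-is-id refl) (allFin _))
                                  (trans (List.map-tabulate id (lookup xs)) (List.tabulate-lookup xs))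

module _ {B : Set} (k : ℕ) (h : Fin k → B) where

  length-map-allFin : length (map h (allFin k)) ≡ k
  length-map-allFin = trans (List.length-map h (allFin k)) (List.length-tabulate id)

  lookup-map-allFin : (i : Fin (length (map h (allFin k)))) (j : Fin k) → toℕ i ≡ toℕ j →
    lookup (map h (allFin k)) i ≡ h j
  lookup-map-allFin i j i≡j =
    trans (lookup-cong (List.map-tabulate id h) i (cast (sym (List.length-tabulate h)) j)
                       (trans i≡j (sym (Fin.toℕ-cast _ j))))
          (List.lookup-tabulate h j)

  ∈-map-allFin⁺ : (i : Fin k) → h i ∈ map h (allFin k)
  ∈-map-allFin⁺ i = ∈-map⁺ h (∈-allFin i)

  ∈-map-allFin⁻ : {z : B} → z ∈ map h (allFin k) → ∃ λ i → h i ≡ z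
  ∈-map-allFin⁻ z∈ with ∈-map⁻ h z∈
  ... | i , _ , z≡hi = i , sym z≡hi

map-allFin-injective : {B : Set} (k : ℕ) (h h′ : Fin k → B) → map h (allFin k) ≡ map h′ (allFin k) → h ≗ h′
map-allFin-injective (suc k) h h′ eq i
  rewrite map-allFin-suc k h | map-allFin-suc k h′ with i
... | fzero = List.∷-injectiveˡ eq
... | fsuc i = map-allFin-injective k (h ∘ fsuc) (h′ ∘ fsuc) (List.∷-injectiveʳ eq) i

map-allFin-Sorted : (k : ℕ) (h : Fin k → ℕ) → h Preserves _<ᶠ_ ⟶ _<_ → Sorted (map h (allFin k))
map-allFin-Sorted k h h-mono = AllPairs.map⁺ (AllPairs.tabulate⁺-< h-mono)

Increasing : ∀ {k m} → (Fin k → Fin m) → Set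
Increasing e = e Preserves _<ᶠ_ ⟶ _<ᶠ_

increasing? : ∀ {k m} (e : Fin k → Fin m) → Dec (Increasing e)
increasing? e = map′ (λ e-mono {i} {j} → e-mono i j) (λ e-mono i j → e-mono)
  (Fin.all? λ i → Fin.all? λ j → (i Fin.<? j) →-dec (e i Fin.<? e j))

increasing-injective : ∀ {k} (h : Fin k → ℕ) → h Preserves _<ᶠ_ ⟶ _<_ → ∀ i j → h i ≡ h j → i ≡ j
increasing-injective h h-mono i j hi≡hj with Fin.<-cmp i j
... | tri< i<j _ _ = ⊥-elim (<-irrefl hi≡hj (h-mono i<j))
... | tri≈ _ i≡j _ = i≡j
... | tri> _ _ j<i = ⊥-elim (<-irrefl (sym hi≡hj) (h-mono j<i))

Increasing-injective : ∀ {k m} (e : Fin k → Fin m) → Increasing e → ∀ i j → e i ≡ e j → i ≡ j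
Increasing-injective e e-mono i j ei≡ej = increasing-injective (toℕ ∘ e) e-mono i j (cong toℕ ei≡ej)

IsSetComp⇒≤ : ∀ {n k} (c : Fin n → Fin k) → IsSetComp c → k ≤ n
IsSetComp⇒≤ c c-onto = Fin.injective⇒≤ {f = proj₁ ∘ c-onto}
  (λ {i} {j} eq → trans (sym (proj₂ (c-onto i))) (trans (cong c eq) (proj₂ (c-onto j))))

record Factorisation {n m : ℕ} (f : Fin n → Fin m) (k : ℕ) : Set where
  constructor factorisation
  field
    c : Fin n → Fin k
    e : Fin k → Fin m
    c-onto : IsSetComp c
    e-mono : Increasing e
    e∘c≗f : ∀ v → e (c v) ≡ f v

factorisation-exists : ∀ {n m} (f : Fin n → Fin m) → Σ (Fin (suc n)) λ K → Factorisation f (toℕ K)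
factorisation-exists {n} {m} f =
  fromℕ< k<1+n , subst (Factorisation f) (sym (Fin.toℕ-fromℕ< k<1+n)) (factorisation c e c-onto e-mono e∘c≗f)
  where
  inImage? : ∀ j → Dec (∃ λ v → f v ≡ j)
  inImage? j = Fin.any? (λ v → f v Fin.≟ j)
  image : List (Fin m)
  image = filter inImage? (allFin m)
  k : ℕ
  k = length image
  e : Fin k → Fin m
  e = lookup image
  e-mono : Increasing e
  e-mono {i} {j} = AllPairs-lookup (AllPairs.filter⁺ inImage? {xs = allFin m} (AllPairs.tabulate⁺-< id)) i j
  f∈image : ∀ v → f v ∈ image
  f∈image v = ∈-filter⁺ inImage? (∈-allFin (f v)) (v , refl)
  c : Fin n → Fin k
  c v = Any.index (f∈image v)
  e∘c≗f : ∀ v → e (c v) ≡ f v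
  e∘c≗f v = sym (lookup-index (f∈image v))
  c-onto : IsSetComp c
  c-onto i with ∈-filter⁻ inImage? {xs = allFin m} (∈-lookup {xs = image} i)
  ... | _ , (v , fv≡ei) = v , Increasing-injective e e-mono _ _ (trans (e∘c≗f v) fv≡ei)
  k<1+n : k < suc n
  k<1+n = s≤s (IsSetComp⇒≤ c c-onto)

module _ {n m : ℕ} {f : Fin n → Fin m} where
  open Factorisation

  -- Both factorisations have the sorted image of f as the image of their increasing part.
  image-≡ : ∀ {k k′} (F : Factorisation f k) (F′ : Factorisation f k′) →
    map (toℕ ∘ e F) (allFin k) ≡ map (toℕ ∘ e F′) (allFin k′)
  image-≡ {k} {k′} F F′ =
    Sorted-≡ (map-allFin-Sorted k _ (e-mono F)) (map-allFin-Sorted k′ _ (e-mono F′)) (image-⊆ F F′) (image-⊆ F′ F)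
    where
    image-⊆ : ∀ {k k′} (F : Factorisation f k) (F′ : Factorisation f k′) →
      map (toℕ ∘ e F) (allFin k) ⊆ map (toℕ ∘ e F′) (allFin k′)
    image-⊆ {k} {k′} F F′ z∈ with ∈-map-allFin⁻ k (toℕ ∘ e F) z∈
    ... | i , refl with c-onto F i
    ... | v , refl = subst (_∈ map (toℕ ∘ e F′) (allFin k′)) (cong toℕ (trans (e∘c≗f F′ v) (sym (e∘c≗f F v))))
                           (∈-map-allFin⁺ k′ (toℕ ∘ e F′) (c F′ v))

  Factorisation-length : ∀ {k k′} → Factorisation f k → Factorisation f k′ → k ≡ k′
  Factorisation-length {k} {k′} F F′ =
    trans (sym (length-map-allFin k (toℕ ∘ e F))) (trans (cong length (image-≡ F F′)) (length-map-allFin k′ (toℕ ∘ e F′)))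

  Factorisation-e : ∀ {k} (F F′ : Factorisation f k) → e F ≗ e F′
  Factorisation-e {k} F F′ i = Fin.toℕ-injective (map-allFin-injective k _ _ (image-≡ F F′) i)

  Factorisation-c : ∀ {k} (F F′ : Factorisation f k) → c F ≗ c F′
  Factorisation-c F F′ v = Increasing-injective (e F) (e-mono F) _ _
    (trans (e∘c≗f F v) (trans (sym (e∘c≗f F′ v)) (sym (Factorisation-e F F′ (c F′ v)))))

module _ {n m : ℕ} where

  factorisationsThrough : ∀ {k} → (Fin n → Fin m) → (Fin n → Fin k) → ℕ
  factorisationsThrough {k} f c = ∑[ e ∈ allFuns k m ] (𝟙 (increasing? e) * 𝟙 ((e ∘ c) ≗? f))

  factorisations : (Fin n → Fin m) → ℕ
  factorisations f = ∑[ K ∈ allFin (suc n) ] ∑[ c ∈ allFuns n (toℕ K) ] (𝟙 (isSetComp? c) * factorisationsThrough f c)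

  factorisationsThrough-≡1 : ∀ {k f} (F : Factorisation f k) →
    𝟙 (isSetComp? (Factorisation.c F)) * factorisationsThrough f (Factorisation.c F) ≡ 1
  factorisationsThrough-≡1 {k} {f} F@(factorisation c e c-onto e-mono e∘c≗f) = begin
    𝟙 (isSetComp? c) * factorisationsThrough f c
      ≡⟨ cong (_* factorisationsThrough f c) (𝟙-yes (isSetComp? c) c-onto) ⟩
    factorisationsThrough f c + 0
      ≡⟨ +-identityʳ _ ⟩
    ∑[ d ∈ allFuns k m ] (𝟙 (increasing? d) * 𝟙 ((d ∘ c) ≗? f))
      ≡⟨ ∑-cong (allFuns k m) (λ d → sym (𝟙-× (increasing? d) ((d ∘ c) ≗? f))) ⟩
    ∑[ d ∈ allFuns k m ] 𝟙 (increasing? d ×-dec (d ∘ c) ≗? f)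
      ≡⟨ ∑-allFuns-𝟙-unique k m e _ (λ d (d-mono , d∘c≗f) → Factorisation-e (factorisation c d c-onto d-mono d∘c≗f) F)
                                    (λ d d≗e → (λ i<j → subst₂ _<ᶠ_ (sym (d≗e _)) (sym (d≗e _)) (e-mono i<j))
                                             , (λ v → trans (d≗e (c v)) (e∘c≗f v))) ⟩
    1 ∎
    where open ≡-Reasoning

  factorisationsThrough-≡0 : ∀ {k f} (c : Fin n → Fin k) → (∀ e → ¬ (IsSetComp c × Increasing e × (∀ v → e (c v) ≡ f v))) →
    𝟙 (isSetComp? c) * factorisationsThrough f c ≡ 0
  factorisationsThrough-≡0 {k} {f} c no-factorisation with isSetComp? c
  ... | no _ = refl
  ... | yes c-onto = trans (+-identityʳ _) (∑-zero (allFuns k m) _ λ e → term≡0 e (increasing? e) ((e ∘ c) ≗? f))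
    where
    term≡0 : ∀ e (p : Dec (Increasing e)) (q : Dec ((e ∘ c) ≗ f)) → 𝟙 p * 𝟙 q ≡ 0
    term≡0 e (yes e-mono) (yes e∘c≗f) = ⊥-elim (no-factorisation e (c-onto , e-mono , e∘c≗f))
    term≡0 e (yes _) (no _) = refl
    term≡0 e (no _) _ = refl

  factorisations≡1 : ∀ f → factorisations f ≡ 1
  factorisations≡1 f with factorisation-exists f
  ... | K₀ , F₀@(factorisation c₀ e₀ c₀-onto e₀-mono e₀∘c₀≗f) = begin
    factorisations f
      ≡⟨ ∑-allFin-δ (suc n) K₀ _ other-length ⟩
    ∑[ c ∈ allFuns n (toℕ K₀) ] (𝟙 (isSetComp? c) * factorisationsThrough f c)
      ≡⟨ ∑-allFuns-δ n (toℕ K₀) c₀ _ other-blocks same-blocks ⟩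
    𝟙 (isSetComp? c₀) * factorisationsThrough f c₀
      ≡⟨ factorisationsThrough-≡1 F₀ ⟩
    1 ∎
    where
    open ≡-Reasoning
    other-length : ∀ K → K ≢ K₀ → ∑[ c ∈ allFuns n (toℕ K) ] (𝟙 (isSetComp? c) * factorisationsThrough f c) ≡ 0
    other-length K K≢K₀ = ∑-zero (allFuns n (toℕ K)) _ λ c → factorisationsThrough-≡0 c λ e (c-onto , e-mono , e∘c≗f) →
      K≢K₀ (Fin.toℕ-injective (Factorisation-length (factorisation c e c-onto e-mono e∘c≗f) F₀))
    other-blocks : ∀ c → ¬ c ≗ c₀ → 𝟙 (isSetComp? c) * factorisationsThrough f c ≡ 0
    other-blocks c c≉c₀ = factorisationsThrough-≡0 c λ e (c-onto , e-mono , e∘c≗f) →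
      c≉c₀ (Factorisation-c (factorisation c e c-onto e-mono e∘c≗f) F₀)
    same-blocks : ∀ c → c ≗ c₀ → 𝟙 (isSetComp? c) * factorisationsThrough f c ≡ 𝟙 (isSetComp? c₀) * factorisationsThrough f c₀
    same-blocks c c≗c₀ = trans (factorisationsThrough-≡1 F) (sym (factorisationsThrough-≡1 F₀))
      where
      F : Factorisation f (toℕ K₀)
      F = factorisation c e₀ (λ i → proj₁ (c₀-onto i) , trans (c≗c₀ _) (proj₂ (c₀-onto i))) e₀-mono
                           (λ v → trans (cong e₀ (c≗c₀ v)) (e₀∘c₀≗f v))

  ∑-allFuns-factorise : (F : (Fin n → Fin m) → ℕ) (G : ∀ {k} → (Fin n → Fin k) → (Fin k → Fin m) → ℕ) →
    (∀ {k f} {c : Fin n → Fin k} {e} → IsSetComp c → Increasing e → (∀ v → e (c v) ≡ f v) → F f ≡ G c e) →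
    ∑ (allFuns n m) F ≡ ∑[ K ∈ allFin (suc n) ] ∑[ c ∈ allFuns n (toℕ K) ]
                          (𝟙 (isSetComp? c) * ∑[ e ∈ allFuns (toℕ K) m ] (𝟙 (increasing? e) * G c e))
  ∑-allFuns-factorise F G F≡G = begin
    ∑ fs F
      ≡⟨ ∑-cong fs (λ f → sym (trans (cong (_* F f) (factorisations≡1 f)) (+-identityʳ (F f)))) ⟩
    ∑[ f ∈ fs ] (factorisations f * F f)
      ≡⟨ ∑-*-swap Ks fs (λ K f → ∑[ c ∈ allFuns n (toℕ K) ] (𝟙 (isSetComp? c) * factorisationsThrough f c)) F ⟩
    ∑[ K ∈ Ks ] ∑[ f ∈ fs ] (∑[ c ∈ allFuns n (toℕ K) ] (𝟙 (isSetComp? c) * factorisationsThrough f c) * F f)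
      ≡⟨ ∑-cong Ks (λ K → ∑-*-swap (allFuns n (toℕ K)) fs (λ c f → 𝟙 (isSetComp? c) * factorisationsThrough f c) F) ⟩
    ∑[ K ∈ Ks ] ∑[ c ∈ allFuns n (toℕ K) ] ∑[ f ∈ fs ] (𝟙 (isSetComp? c) * factorisationsThrough f c * F f)
      ≡⟨ ∑-cong Ks (λ K → ∑-cong (allFuns n (toℕ K)) λ c →
           trans (∑-*-assoc (𝟙 (isSetComp? c)) fs _ F) (𝟙-*-cong (isSetComp? c) (through c))) ⟩
    ∑[ K ∈ Ks ] ∑[ c ∈ allFuns n (toℕ K) ] (𝟙 (isSetComp? c) * ∑[ e ∈ allFuns (toℕ K) m ] (𝟙 (increasing? e) * G c e)) ∎
    where
    open ≡-Reasoning
    fs : List (Fin n → Fin m)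
    fs = allFuns n m
    Ks : List (Fin (suc n))
    Ks = allFin (suc n)
    through : ∀ {k} (c : Fin n → Fin k) → IsSetComp c →
      ∑[ f ∈ fs ] (factorisationsThrough f c * F f) ≡ ∑[ e ∈ allFuns k m ] (𝟙 (increasing? e) * G c e)
    through {k} c c-onto = begin
      ∑[ f ∈ fs ] (factorisationsThrough f c * F f)
        ≡⟨ ∑-*-swap (allFuns k m) fs (λ e f → 𝟙 (increasing? e) * 𝟙 ((e ∘ c) ≗? f)) F ⟩
      ∑[ e ∈ allFuns k m ] ∑[ f ∈ fs ] (𝟙 (increasing? e) * 𝟙 ((e ∘ c) ≗? f) * F f)
        ≡⟨ ∑-cong (allFuns k m) (λ e → ∑-*-assoc (𝟙 (increasing? e)) fs _ F) ⟩
      ∑[ e ∈ allFuns k m ] (𝟙 (increasing? e) * ∑[ f ∈ fs ] (𝟙 ((e ∘ c) ≗? f) * F f))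
        ≡⟨ ∑-cong (allFuns k m) (λ e → 𝟙-*-cong (increasing? e) λ e-mono →
             ∑-allFuns-at n m (e ∘ c) F (G c e) (λ f e∘c≗f → F≡G c-onto e-mono e∘c≗f)) ⟩
      ∑[ e ∈ allFuns k m ] (𝟙 (increasing? e) * G c e) ∎

IncreasingFrom : ∀ {k x} → ℕ → (Fin k → Fin x) → Set
IncreasingFrom b e = Increasing e × (∀ i → b ≤ toℕ (e i))

increasingFrom? : ∀ {k x} (b : ℕ) (e : Fin k → Fin x) → Dec (IncreasingFrom b e)
increasingFrom? b e = increasing? e ×-dec Fin.all? (λ i → b ≤? toℕ (e i))

IncreasingFrom-suc : ∀ {k x} b (e : Fin (suc k) → Fin x) →
  IncreasingFrom b e ⇔ (b ≤ toℕ (e fzero) × IncreasingFrom (suc (toℕ (e fzero))) (e ∘ fsuc))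
IncreasingFrom-suc b e = mk⇔
  (λ (e-mono , b≤e) → b≤e fzero , (e-mono ∘ s≤s) , (λ i → e-mono {fzero} {fsuc i} (s≤s z≤n)))
  (λ (b≤e0 , e-mono , e0<e) → mono e-mono e0<e , from b≤e0 e0<e)
  where
  mono : Increasing (e ∘ fsuc) → (∀ i → toℕ (e fzero) < toℕ (e (fsuc i))) → Increasing e
  mono e-mono e0<e {fzero} {fsuc j} _ = e0<e j
  mono e-mono e0<e {fsuc i} {fsuc j} (s≤s i<j) = e-mono i<j
  from : b ≤ toℕ (e fzero) → (∀ i → toℕ (e fzero) < toℕ (e (fsuc i))) → ∀ i → b ≤ toℕ (e i)
  from b≤e0 e0<e fzero = b≤e0
  from b≤e0 e0<e (fsuc i) = ≤-trans b≤e0 (<⇒≤ (e0<e i))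

∑-hockeyStick : (x b k : ℕ) → ∑[ i ∈ allFin x ] (𝟙 (b ≤? toℕ i) * ((x ∸ suc (toℕ i)) C k)) ≡ (x ∸ b) C suc k
∑-hockeyStick zero zero k = refl
∑-hockeyStick zero (suc b) k = refl
∑-hockeyStick (suc x) zero k = begin
  ∑[ i ∈ allFin (suc x) ] (𝟙 (0 ≤? toℕ i) * ((suc x ∸ suc (toℕ i)) C k))
    ≡⟨ ∑-allFin-suc x (λ i → 𝟙 (0 ≤? toℕ i) * ((suc x ∸ suc (toℕ i)) C k)) ⟩
  x C k + 0 + ∑[ i ∈ allFin x ] (𝟙 (0 ≤? suc (toℕ i)) * ((x ∸ suc (toℕ i)) C k))
    ≡⟨ cong₂ _+_ (+-identityʳ (x C k)) (∑-cong (allFin x) λ i →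
         cong (_* ((x ∸ suc (toℕ i)) C k)) (𝟙-⇔ (0 ≤? suc (toℕ i)) (0 ≤? toℕ i) (λ _ → z≤n) (λ _ → z≤n))) ⟩
  x C k + ∑[ i ∈ allFin x ] (𝟙 (0 ≤? toℕ i) * ((x ∸ suc (toℕ i)) C k))
    ≡⟨ cong (x C k +_) (∑-hockeyStick x zero k) ⟩
  x C k + x C suc k
    ≡⟨ nCk+nC[k+1]≡[n+1]C[k+1] x k ⟩
  suc x C suc k ∎
  where open ≡-Reasoning
∑-hockeyStick (suc x) (suc b) k = begin
  ∑[ i ∈ allFin (suc x) ] (𝟙 (suc b ≤? toℕ i) * ((suc x ∸ suc (toℕ i)) C k))
    ≡⟨ ∑-allFin-suc x (λ i → 𝟙 (suc b ≤? toℕ i) * ((suc x ∸ suc (toℕ i)) C k)) ⟩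
  ∑[ i ∈ allFin x ] (𝟙 (suc b ≤? suc (toℕ i)) * ((x ∸ suc (toℕ i)) C k))
    ≡⟨ ∑-cong (allFin x) (λ i → cong (_* ((x ∸ suc (toℕ i)) C k)) (𝟙-⇔ (suc b ≤? suc (toℕ i)) (b ≤? toℕ i) s≤s⁻¹ s≤s)) ⟩
  ∑[ i ∈ allFin x ] (𝟙 (b ≤? toℕ i) * ((x ∸ suc (toℕ i)) C k))
    ≡⟨ ∑-hockeyStick x b k ⟩
  (x ∸ b) C suc k ∎
  where open ≡-Reasoning

-- The first value i of e leaves the x ∸ suc i values above i for the rest of e.
count-IncreasingFrom : (k x b : ℕ) → ∑[ e ∈ allFuns k x ] 𝟙 (increasingFrom? b e) ≡ (x ∸ b) C k
count-IncreasingFrom zero x b = 𝟙-yes (increasingFrom? {0} {x} b (λ ())) ((λ {}) , (λ ()))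
count-IncreasingFrom (suc k) x b =
  trans (∑-concatMap _ (allFin x) _)
  (trans (∑-cong (allFin x) λ i →
            trans (∑-map _ (allFuns k x) _)
            (trans (∑-cong (allFuns k x) (λ e → 𝟙-increasingFrom-suc _))
            (trans (∑-*ˡ (𝟙 (b ≤? toℕ i)) (allFuns k x) _)
                   (cong (𝟙 (b ≤? toℕ i) *_) (count-IncreasingFrom k x (suc (toℕ i)))))))
         (∑-hockeyStick x b k))
  where
  𝟙-increasingFrom-suc : (e : Fin (suc k) → Fin x) → 𝟙 (increasingFrom? b e)
    ≡ 𝟙 (b ≤? toℕ (e fzero)) * 𝟙 (increasingFrom? (suc (toℕ (e fzero))) (e ∘ fsuc))
  𝟙-increasingFrom-suc e =
    trans (𝟙-⇔ (increasingFrom? b e) ((b ≤? toℕ (e fzero)) ×-dec increasingFrom? (suc (toℕ (e fzero))) (e ∘ fsuc))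
               (Equivalence.to (IncreasingFrom-suc b e)) (Equivalence.from (IncreasingFrom-suc b e)))
          (𝟙-× (b ≤? toℕ (e fzero)) (increasingFrom? (suc (toℕ (e fzero))) (e ∘ fsuc)))

count-Increasing : (k x : ℕ) → ∑[ e ∈ allFuns k x ] 𝟙 (increasing? e) ≡ x C k
count-Increasing k x = trans (∑-cong (allFuns k x) (λ e → 𝟙-⇔ (increasing? e) (increasingFrom? 0 e) (_, (λ _ → z≤n)) proj₁))
                             (count-IncreasingFrom k x 0)

module _ {A A′ : Set} (σ : A ↔ A′) (Q : Bool → Set) (Q-irrelevant : ∀ b (p q : Q b) → p ≡ q)
         (P : A → Bool) (P′ : A′ → Bool) (P′∘σ≗P : ∀ a → P′ (Inverse.to σ a) ≡ P a) where

  restrict-↔ : Σ A (Q ∘ P) ↔ Σ A′ (Q ∘ P′)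
  restrict-↔ = mk↔ₛ′ to from (λ y → Σ-≡ P′ (Inverse.strictlyInverseˡ σ (proj₁ y)))
                             (λ x → Σ-≡ P (Inverse.strictlyInverseʳ σ (proj₁ x)))
    where
    Σ-≡ : ∀ {X : Set} (R : X → Bool) {a a′ : X} → a ≡ a′ → {p : Q (R a)} {p′ : Q (R a′)} → (a , p) ≡ (a′ , p′)
    Σ-≡ R {a} refl = cong (a ,_) (Q-irrelevant (R a) _ _)
    to : Σ A (Q ∘ P) → Σ A′ (Q ∘ P′)
    to (a , p) = Inverse.to σ a , subst Q (sym (P′∘σ≗P a)) p
    from : Σ A′ (Q ∘ P′) → Σ A (Q ∘ P)
    from (a′ , p′) = Inverse.from σ a′
                   , subst Q (trans (sym (cong P′ (Inverse.strictlyInverseˡ σ a′))) (P′∘σ≗P (Inverse.from σ a′))) p′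

module _ (HM : LinHopfMonoid) (χ : LinCharacter HM) where
  open LinHopfMonoid HM
  open LinCharacter χ

  module _ {A A′ : Set} (σ : A ↔ A′) {k : ℕ} (B : Fin (suc k) → A → Bool) (B′ : Fin (suc k) → A′ → Bool)
           (B′∘σ≗B : ∀ i a → B′ i (Inverse.to σ a) ≡ B i a) where

    σ-Sub : Sub A (B fzero) ↔ Sub A′ (B′ fzero)
    σ-Sub = restrict-↔ σ T T-irr (B fzero) (B′ fzero) (B′∘σ≗B fzero)

    σ-Compl : Compl A (B fzero) ↔ Compl A′ (B′ fzero)
    σ-Compl = restrict-↔ σ (T ∘ not) (T-irr ∘ not) (B fzero) (B′ fzero) (B′∘σ≗B fzero)

    split-mapH : ∀ x → mapH (split (B′ fzero)) (mapH σ x) ≡ mapH (σ-Sub ⊎-↔ σ-Compl) (mapH (split (B fzero)) x)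
    split-mapH x = trans (sym (mapH-∘ σ (split (B′ fzero)) x))
                  (trans (mapH-cong _ _ square x) (mapH-∘ (split (B fzero)) (σ-Sub ⊎-↔ σ-Compl) x))
      where
      unsplit-σ : ∀ y → Inverse.from (split (B′ fzero)) (Inverse.to (σ-Sub ⊎-↔ σ-Compl) y)
                      ≡ Inverse.to σ (Inverse.from (split (B fzero)) y)
      unsplit-σ (inj₁ _) = refl
      unsplit-σ (inj₂ _) = refl
      square : ∀ a → Inverse.to (split (B′ fzero) ↔-∘ σ) a ≡ Inverse.to ((σ-Sub ⊎-↔ σ-Compl) ↔-∘ split (B fzero)) a
      square a = Injection.injective (↔⇒↣ (↔-sym (split (B′ fzero)))) (begin
        Inverse.from (split (B′ fzero)) (Inverse.to (split (B′ fzero)) (Inverse.to σ a))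
          ≡⟨ Inverse.strictlyInverseʳ (split (B′ fzero)) (Inverse.to σ a) ⟩
        Inverse.to σ a
          ≡⟨ cong (Inverse.to σ) (sym (Inverse.strictlyInverseʳ (split (B fzero)) a)) ⟩
        Inverse.to σ (Inverse.from (split (B fzero)) (Inverse.to (split (B fzero)) a))
          ≡⟨ sym (unsplit-σ (Inverse.to (split (B fzero)) a)) ⟩
        Inverse.from (split (B′ fzero)) (Inverse.to (σ-Sub ⊎-↔ σ-Compl) (Inverse.to (split (B fzero)) a)) ∎)
        where open ≡-Reasoning

  phiC-mapH : ∀ {A A′ : Set} (σ : A ↔ A′) (k : ℕ) (B : Fin k → A → Bool) (B′ : Fin k → A′ → Bool) →
    (∀ i a → B′ i (Inverse.to σ a) ≡ B i a) → ∀ x → phiC HM χ k B′ (mapH σ x) ≡ phiC HM χ k B x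
  phiC-mapH σ zero B B′ B′∘σ≗B x = refl
  phiC-mapH σ (suc zero) B B′ B′∘σ≗B x = φ-nat σ x
  phiC-mapH {A} {A′} σ (suc (suc k)) B B′ B′∘σ≗B x =
    trans (cong (maybe′ φC′ false) (trans (cong Δ (split-mapH σ B B′ B′∘σ≗B x))
                                          (Δ-nat σ-Sub′ σ-Compl′ (mapH (split (B fzero)) x))))
          (maybe-map (phiC-mapH σ-Compl′ (suc k) (λ i a → B (fsuc i) (proj₁ a)) (λ i a → B′ (fsuc i) (proj₁ a))
                                (λ i a → B′∘σ≗B (fsuc i) (proj₁ a)))
                     (Δ (mapH (split (B fzero)) x)))
    where
    σ-Sub′ : Sub A (B fzero) ↔ Sub A′ (B′ fzero)
    σ-Sub′ = σ-Sub σ B B′ B′∘σ≗B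
    σ-Compl′ : Compl A (B fzero) ↔ Compl A′ (B′ fzero)
    σ-Compl′ = σ-Compl σ B B′ B′∘σ≗B
    φC′ : H (Sub A′ (B′ fzero)) × H (Compl A′ (B′ fzero)) → Bool
    φC′ (u , w) = φ u ∧ phiC HM χ (suc k) (λ i a → B′ (fsuc i) (proj₁ a)) w
    φC : H (Sub A (B fzero)) × H (Compl A (B fzero)) → Bool
    φC (u , w) = φ u ∧ phiC HM χ (suc k) (λ i a → B (fsuc i) (proj₁ a)) w
    -- The induction hypothesis is an argument so that the termination checker sees the recursive call.
    maybe-map : (∀ w → phiC HM χ (suc k) (λ i a → B′ (fsuc i) (proj₁ a)) (mapH σ-Compl′ w)
                     ≡ phiC HM χ (suc k) (λ i a → B (fsuc i) (proj₁ a)) w) →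
                ∀ m → maybe′ φC′ false (Maybe.map (×-map (mapH σ-Sub′) (mapH σ-Compl′)) m) ≡ maybe′ φC false m
    maybe-map _ nothing = refl
    maybe-map phiC-rest (just (u , w)) = cong₂ _∧_ (φ-nat σ-Sub′ u) (phiC-rest w)

  phiC-cong : ∀ {A : Set} {k k′ : ℕ} (B : Fin k → A → Bool) (B′ : Fin k′ → A → Bool) → k ≡ k′ →
    (∀ i j a → toℕ i ≡ toℕ j → B′ j a ≡ B i a) → ∀ x → phiC HM χ k′ B′ x ≡ phiC HM χ k B x
  phiC-cong {k = k} B B′ refl B′≗B x =
    trans (cong (phiC HM χ k B′) (sym (mapH-id x))) (phiC-mapH (↔-id _) k B B′ (λ i a → B′≗B i i a refl) x)

module _ {n : ℕ} (g : Fin n → ℕ) where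

  inValues? : ∀ j → Dec (∃ λ v → g v ≡ j)
  inValues? j = Fin.any? (λ v → g v ≟ j)

  valuesOf-Sorted : Sorted (valuesOf g)
  valuesOf-Sorted = AllPairs.filter⁺ inValues? (AllPairs.applyUpTo⁺₁ id (suc (sum (map g (allFin n)))) (λ i<j _ → i<j))

  ∈-valuesOf⁻ : ∀ {z} → z ∈ valuesOf g → ∃ λ v → g v ≡ z
  ∈-valuesOf⁻ z∈ = proj₂ (∈-filter⁻ inValues? {xs = upTo (suc (sum (map g (allFin n))))} z∈)

  ∈-valuesOf⁺ : ∀ v → g v ∈ valuesOf g
  ∈-valuesOf⁺ v = ∈-filter⁺ inValues? (∈-upTo⁺ (s≤s (∈⇒≤sum (∈-map⁺ g (∈-allFin v))))) (v , refl)
    where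
    ∈⇒≤sum : ∀ {x xs} → x ∈ xs → x ≤ sum xs
    ∈⇒≤sum {xs = y ∷ ys} (here refl) = m≤m+n y (sum ys)
    ∈⇒≤sum {xs = y ∷ ys} (there x∈ys) = ≤-trans (∈⇒≤sum x∈ys) (m≤n+m (sum ys) y)

module ColoringThrough {n k : ℕ} (c : Fin n → Fin k) (c-onto : IsSetComp c)
                       (h : Fin k → ℕ) (h-mono : h Preserves _<ᶠ_ ⟶ _<_)
                       (g : Fin n → ℕ) (g≗h∘c : ∀ v → g v ≡ h (c v)) where

  valuesOf-≡ : valuesOf g ≡ map h (allFin k)
  valuesOf-≡ = Sorted-≡ (valuesOf-Sorted g) (map-allFin-Sorted k h h-mono) values⊆image image⊆values
    where
    values⊆image : valuesOf g ⊆ map h (allFin k)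
    values⊆image z∈ with ∈-valuesOf⁻ g z∈
    ... | v , refl = subst (_∈ map h (allFin k)) (sym (g≗h∘c v)) (∈-map-allFin⁺ k h (c v))
    image⊆values : map h (allFin k) ⊆ valuesOf g
    image⊆values z∈ with ∈-map-allFin⁻ k h z∈
    ... | i , refl with c-onto i
    ... | v , refl = subst (_∈ valuesOf g) (g≗h∘c v) (∈-valuesOf⁺ g v)

  length-valuesOf : k ≡ length (valuesOf g)
  length-valuesOf = sym (trans (cong length valuesOf-≡) (length-map-allFin k h))

  blocksOfColoring-≡ : ∀ i j v → toℕ i ≡ toℕ j → blocksOfColoring g j v ≡ blocksOf c i v
  blocksOfColoring-≡ i j v i≡j = begin
    ⌊ g v ≟ lookup (valuesOf g) j ⌋ ≡⟨ cong (λ z → ⌊ g v ≟ z ⌋) value-j ⟩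
    ⌊ g v ≟ h i ⌋                   ≡⟨ ⌊⌋-⇔ (g v ≟ h i) (c v Fin.≟ i) (increasing-injective h h-mono _ _ ∘ trans (sym (g≗h∘c v)))
                                                                        (trans (g≗h∘c v) ∘ cong h) ⟩
    ⌊ c v Fin.≟ i ⌋                 ∎
    where
    open ≡-Reasoning
    value-j : lookup (valuesOf g) j ≡ h i
    value-j = trans (lookup-cong valuesOf-≡ j (cast (sym (length-map-allFin k h)) i) (trans (sym i≡j) (sym (Fin.toℕ-cast _ i))))
                    (lookup-map-allFin k h _ i (Fin.toℕ-cast _ i))

  phiC-coloring : (HM : LinHopfMonoid) (χ : LinCharacter HM) (x : LinHopfMonoid.H HM (Fin n)) →
    phiC HM χ (length (valuesOf g)) (blocksOfColoring g) x ≡ phiC HM χ k (blocksOf c) x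
  phiC-coloring HM χ = phiC-cong HM χ (blocksOf c) (blocksOfColoring g) length-valuesOf blocksOfColoring-≡

  FixedF⇔FixedC : (σ : Perm n) → FixedF σ g ⇔ FixedC σ c
  FixedF⇔FixedC σ = mk⇔ (λ fixed v → increasing-injective h h-mono _ _ (trans (sym (g≗h∘c _)) (trans (fixed v) (g≗h∘c v))))
                         (λ fixed v → trans (g≗h∘c _) (trans (cong h (fixed v)) (sym (g≗h∘c v))))

≢0? : ∀ b → Dec (b ≢ 0)
≢0? b = ¬? (b ≟ 0)

_≡L?_ : (α β : List ℕ) → Dec (α ≡ β)
_≡L?_ = List.≡-dec _≟_

Mcoeff≡𝟙 : ∀ α β → Mcoeff α β ≡ 𝟙 (filter ≢0? β ≡L? α)
Mcoeff≡𝟙 α β with filter ≢0? β ≡L? α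
... | yes _ = refl
... | no _ = refl

blockSize : ∀ {n k} → (Fin n → Fin k) → Fin k → ℕ
blockSize {n} c j = count (λ v → c v Fin.≟ j) (allFin n)

blockSize-pos : ∀ {n k} {c : Fin n → Fin k} → IsSetComp c → ∀ j → 0 < blockSize c j
blockSize-pos {c = c} c-onto j = count-∈ (λ v → c v Fin.≟ j) (∈-allFin (proj₁ (c-onto j))) (proj₂ (c-onto j))

module _ {n : ℕ} (β : List ℕ) where

  HasContent : (Fin n → Fin (length β)) → Set
  HasContent f = ∀ i → count (λ v → f v Fin.≟ i) (allFin n) ≡ lookup β i

  hasContent? : (f : Fin n → Fin (length β)) → Dec (HasContent f)
  hasContent? f = Fin.all? (λ i → count (λ v → f v Fin.≟ i) (allFin n) ≟ lookup β i)

  HasContent-cong : ∀ {f f′} → f ≗ f′ → HasContent f → HasContent f′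
  HasContent-cong f≗f′ f-content i =
    trans (count-cong _ _ (allFin n) (λ v → trans (f≗f′ v)) (λ v → trans (sym (f≗f′ v)))) (f-content i)

-- For increasing e, the coloring e ∘ c has content β iff β is α(c) spread out over the positions
-- e 0 < e 1 < ⋯, so e must enumerate the support of β.
module Content {n k : ℕ} (c : Fin n → Fin k) (c-onto : IsSetComp c) (β : List ℕ) where

  m : ℕ
  m = length β

  module _ (e : Fin k → Fin m) (e-mono : Increasing e) where

    count-e∘c-image : ∀ j → count (λ v → e (c v) Fin.≟ e j) (allFin n) ≡ blockSize c j
    count-e∘c-image j = count-cong _ _ (allFin n) (λ v → Increasing-injective e e-mono _ _) (λ v → cong e)

    count-e∘c-outside : ∀ i → (∀ j → e j ≢ i) → count (λ v → e (c v) Fin.≟ i) (allFin n) ≡ 0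
    count-e∘c-outside i i∉image = count-none _ (allFin n) (λ v → i∉image (c v))

    lookup-e : HasContent β (e ∘ c) → ∀ j → lookup β (e j) ≡ blockSize c j
    lookup-e e∘c-content j = trans (sym (e∘c-content (e j))) (count-e∘c-image j)

  support : List (Fin m)
  support = filter (≢0? ∘ lookup β) (allFin m)

  support-sorted : AllPairs _<ᶠ_ support
  support-sorted = AllPairs.filter⁺ (≢0? ∘ lookup β) {xs = allFin m} (AllPairs.tabulate⁺-< id)

  filter-≢0 : filter ≢0? β ≡ map (lookup β) support
  filter-≢0 = begin
    filter ≢0? β                           ≡⟨ cong (filter ≢0?) (trans (List.map-tabulate id (lookup β)) (List.tabulate-lookup β)) ⟨
    filter ≢0? (map (lookup β) (allFin m)) ≡⟨ filter-map ≢0? (lookup β) (allFin m) ⟩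
    map (lookup β) support                 ∎
    where open ≡-Reasoning

  module _ {e : Fin k → Fin m} (e-mono : Increasing e) (e∘c-content : HasContent β (e ∘ c)) where

    support-≡ : support ≡ map e (allFin k)
    support-≡ = List.map-injective Fin.toℕ-injective (trans
      (Sorted-≡ (AllPairs.map⁺ support-sorted) (map-allFin-Sorted k (toℕ ∘ e) e-mono) support⊆image image⊆support)
      (List.map-∘ (allFin k)))
      where
      support⊆image : map toℕ support ⊆ map (toℕ ∘ e) (allFin k)
      support⊆image z∈ with ∈-map⁻ toℕ z∈
      ... | i , i∈support , refl with Fin.any? (λ j → e j Fin.≟ i)
      ... | yes (j , refl) = ∈-map-allFin⁺ k (toℕ ∘ e) j
      ... | no i∉image = ⊥-elim (proj₂ (∈-filter⁻ (≢0? ∘ lookup β) {xs = allFin m} i∈support)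
                           (trans (sym (e∘c-content i)) (count-e∘c-outside e e-mono i (λ j ej≡i → i∉image (j , ej≡i)))))
      image⊆support : map (toℕ ∘ e) (allFin k) ⊆ map toℕ support
      image⊆support z∈ with ∈-map-allFin⁻ k (toℕ ∘ e) z∈
      ... | j , refl = ∈-map⁺ toℕ (∈-filter⁺ (≢0? ∘ lookup β) (∈-allFin (e j))
                         (λ βej≡0 → <-irrefl (sym (trans (sym (lookup-e e e-mono e∘c-content j)) βej≡0)) (blockSize-pos c-onto j)))

    content⇒filter≡type : filter ≢0? β ≡ typeOf c
    content⇒filter≡type = begin
      filter ≢0? β                       ≡⟨ filter-≢0 ⟩
      map (lookup β) support            ≡⟨ cong (map (lookup β)) support-≡ ⟩
      map (lookup β) (map e (allFin k)) ≡⟨ List.map-∘ (allFin k) ⟨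
      map (lookup β ∘ e) (allFin k)     ≡⟨ List.map-cong (lookup-e e e-mono e∘c-content) (allFin k) ⟩
      map (blockSize c) (allFin k)          ∎
      where open ≡-Reasoning

  content-unique : ∀ {e e′} → Increasing e → HasContent β (e ∘ c) → Increasing e′ → HasContent β (e′ ∘ c) → e ≗ e′
  content-unique e-mono e-content e′-mono e′-content =
    map-allFin-injective k _ _ (trans (sym (support-≡ e-mono e-content)) (support-≡ e′-mono e′-content))

  module _ (filter≡type : filter ≢0? β ≡ typeOf c) where

    k≡length-support : k ≡ length support
    k≡length-support = begin
      k                                  ≡⟨ length-map-allFin k (blockSize c) ⟨
      length (typeOf c)                  ≡⟨ cong length filter≡type ⟨
      length (filter ≢0? β)              ≡⟨ cong length filter-≢0 ⟩
      length (map (lookup β) support)    ≡⟨ List.length-map (lookup β) support ⟩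
      length support                     ∎
      where open ≡-Reasoning

    e₀ : Fin k → Fin m
    e₀ = lookup support ∘ cast k≡length-support

    e₀-mono : Increasing e₀
    e₀-mono {i} {j} i<j = AllPairs-lookup support-sorted _ _
      (subst₂ _<_ (sym (Fin.toℕ-cast k≡length-support i)) (sym (Fin.toℕ-cast k≡length-support j)) i<j)

    e₀-image : map e₀ (allFin k) ≡ support
    e₀-image = map-lookup-allFin support k≡length-support

    lookup-e₀ : ∀ j → lookup β (e₀ j) ≡ blockSize c j
    lookup-e₀ = map-allFin-injective k (lookup β ∘ e₀) (blockSize c) (begin
      map (lookup β ∘ e₀) (allFin k)         ≡⟨ List.map-∘ (allFin k) ⟩
      map (lookup β) (map e₀ (allFin k))     ≡⟨ cong (map (lookup β)) e₀-image ⟩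
      map (lookup β) support                 ≡⟨ filter-≢0 ⟨
      filter ≢0? β                           ≡⟨ filter≡type ⟩
      map (blockSize c) (allFin k)               ∎)
      where open ≡-Reasoning

    e₀-content : HasContent β (e₀ ∘ c)
    e₀-content i with Fin.any? (λ j → e₀ j Fin.≟ i)
    ... | yes (j , refl) = trans (count-e∘c-image e₀ e₀-mono j) (sym (lookup-e₀ j))
    ... | no i∉image = trans (count-e∘c-outside e₀ e₀-mono i (λ j e₀j≡i → i∉image (j , e₀j≡i))) (sym βi≡0)
      where
      βi≡0 : lookup β i ≡ 0
      βi≡0 with lookup β i ≟ 0
      ... | yes βi≡0 = βi≡0
      ... | no βi≢0 with ∈-map-allFin⁻ k e₀ (subst (i ∈_) (sym e₀-image) (∈-filter⁺ (≢0? ∘ lookup β) (∈-allFin i) βi≢0))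
      ...   | j , e₀j≡i = ⊥-elim (i∉image (j , e₀j≡i))

count-content : ∀ {n k} (c : Fin n → Fin k) → IsSetComp c → ∀ β →
  ∑[ e ∈ allFuns k (length β) ] (𝟙 (increasing? e) * 𝟙 (hasContent? β (e ∘ c))) ≡ Mcoeff (typeOf c) β
count-content {n} {k} c c-onto β rewrite Mcoeff≡𝟙 (typeOf c) β with filter ≢0? β ≡L? typeOf c
... | yes filter≡type =
  trans (∑-cong (allFuns k m) (λ e → sym (𝟙-× (increasing? e) (hasContent? β (e ∘ c)))))
        (∑-allFuns-𝟙-unique k m (e₀ filter≡type) _
          (λ e (e-mono , e-content) → content-unique e-mono e-content (e₀-mono filter≡type) (e₀-content filter≡type))
          (λ e e≗e₀ → (λ i<j → subst₂ _<ᶠ_ (sym (e≗e₀ _)) (sym (e≗e₀ _)) (e₀-mono filter≡type i<j))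
                    , HasContent-cong β (sym ∘ e≗e₀ ∘ c) (e₀-content filter≡type)))
  where open Content c c-onto β
... | no filter≢type = ∑-zero (allFuns k m) _ λ e → no-content e (increasing? e) (hasContent? β (e ∘ c))
  where
  open Content c c-onto β
  no-content : ∀ e (p : Dec (Increasing e)) (q : Dec (HasContent β (e ∘ c))) → 𝟙 p * 𝟙 q ≡ 0
  no-content e (yes e-mono) (yes e-content) = ⊥-elim (filter≢type (content⇒filter≡type e-mono e-content))
  no-content e (yes _) (no _) = refl
  no-content e (no _) _ = refl

IsComposition : ℕ → List ℕ → Set
IsComposition n α = All (0 <_) α × sum α ≡ n

isComposition? : ∀ n α → Dec (IsComposition n α)
isComposition? n α = All.all? (0 <?_) α ×-dec (sum α ≟ n)

IsComposition⇒length≤ : ∀ n α → IsComposition n α → length α ≤ n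
IsComposition⇒length≤ n [] _ = z≤n
IsComposition⇒length≤ n (a ∷ α) (0<a ∷ α-pos , refl) =
  ≤-trans (s≤s (IsComposition⇒length≤ (sum α) α (α-pos , refl))) (+-monoˡ-≤ (sum α) 0<a)

-- `bump` is local to the definition of `compositions`, so it is abstracted through its two defining equations.
multiplicity-compositions : ∀ n t → ∑[ α ∈ compositions n ] 𝟙 (t ≡L? α) ≡ 𝟙 (isComposition? n t)
multiplicity-compositions zero [] = refl
multiplicity-compositions zero (a ∷ t) =
  trans (+-identityʳ _) (trans (𝟙-no ((a ∷ t) ≡L? []) (λ ())) (sym (𝟙-no (isComposition? 0 (a ∷ t)) not-composition)))
  where
  not-composition : ¬ IsComposition 0 (a ∷ t)
  not-composition (0<a ∷ _ , a+≡0) = <-irrefl (sym (m+n≡0⇒m≡0 a a+≡0)) 0<a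
multiplicity-compositions (suc n) t =
  trans (∑-++ (map (1 ∷_) Cs) (concatMap _ Cs) _) (by-bump _ refl (λ _ _ → refl) t)
  where
  Cs : List (List ℕ)
  Cs = compositions n
  IH : ∀ t → ∑[ α ∈ Cs ] 𝟙 (t ≡L? α) ≡ 𝟙 (isComposition? n t)
  IH = multiplicity-compositions n
  by-bump : (bump : List ℕ → List (List ℕ)) → bump [] ≡ [] → (∀ a as → bump (a ∷ as) ≡ (suc a ∷ as) ∷ []) → ∀ t →
    ∑[ α ∈ map (1 ∷_) Cs ] 𝟙 (t ≡L? α) + ∑[ α ∈ concatMap bump Cs ] 𝟙 (t ≡L? α) ≡ 𝟙 (isComposition? (suc n) t)
  by-bump bump bump-[] bump-∷ t = trans (cong₂ _+_ (∑-map (1 ∷_) Cs _) (∑-concatMap bump Cs _)) (by-head t)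
    where
    bumped : List ℕ → List ℕ → ℕ
    bumped t α = ∑[ β ∈ bump α ] 𝟙 (t ≡L? β)
    bumped-≡0 : ∀ t → (∀ a as → t ≢ suc a ∷ as) → ∀ α → bumped t α ≡ 0
    bumped-≡0 t t≢ [] rewrite bump-[] = refl
    bumped-≡0 t t≢ (a ∷ as) rewrite bump-∷ a as = trans (+-identityʳ _) (𝟙-no (t ≡L? (suc a ∷ as)) (t≢ a as))
    bumped-suc : ∀ b as α → bumped (suc b ∷ as) α ≡ 𝟙 ((b ∷ as) ≡L? α)
    bumped-suc b as [] rewrite bump-[] = sym (𝟙-no ((b ∷ as) ≡L? []) (λ ()))
    bumped-suc b as (a ∷ α) rewrite bump-∷ a α = trans (+-identityʳ _) (𝟙-⇔ ((suc b ∷ as) ≡L? (suc a ∷ α)) ((b ∷ as) ≡L? (a ∷ α))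
      (λ eq → cong₂ _∷_ (suc-injective (List.∷-injectiveˡ eq)) (List.∷-injectiveʳ eq))
      (λ eq → cong₂ _∷_ (cong suc (List.∷-injectiveˡ eq)) (List.∷-injectiveʳ eq)))
    ones-≡0 : ∀ t → (∀ as → t ≢ 1 ∷ as) → ∑[ α ∈ Cs ] 𝟙 (t ≡L? (1 ∷ α)) ≡ 0
    ones-≡0 t t≢ = ∑-zero Cs _ (λ α → 𝟙-no (t ≡L? (1 ∷ α)) (t≢ α))
    by-head : ∀ t → ∑[ α ∈ Cs ] 𝟙 (t ≡L? (1 ∷ α)) + ∑ Cs (bumped t) ≡ 𝟙 (isComposition? (suc n) t)
    by-head [] = trans (cong₂ _+_ (ones-≡0 [] (λ _ ())) (∑-zero Cs _ (bumped-≡0 [] (λ _ _ ()))))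
                       (sym (𝟙-no (isComposition? (suc n) []) (λ ())))
    by-head (0 ∷ as) = trans (cong₂ _+_ (ones-≡0 (0 ∷ as) (λ _ ())) (∑-zero Cs _ (bumped-≡0 (0 ∷ as) (λ _ _ ()))))
                             (sym (𝟙-no (isComposition? (suc n) (0 ∷ as)) (λ { (() ∷ _ , _) })))
    by-head (1 ∷ as) = trans (cong₂ _+_
        (trans (∑-cong Cs (λ α → 𝟙-⇔ ((1 ∷ as) ≡L? (1 ∷ α)) (as ≡L? α) List.∷-injectiveʳ (cong (1 ∷_)))) (IH as))
        (trans (∑-cong Cs (bumped-suc 0 as)) (trans (IH (0 ∷ as)) (𝟙-no (isComposition? n (0 ∷ as)) (λ { (() ∷ _ , _) })))))
      (trans (+-identityʳ _) (𝟙-⇔ (isComposition? n as) (isComposition? (suc n) (1 ∷ as))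
        (λ (as-pos , Σas≡n) → (s≤s z≤n ∷ as-pos) , cong suc Σas≡n)
        (λ { (_ ∷ as-pos , Σ≡) → as-pos , suc-injective Σ≡ })))
    by-head (suc (suc b) ∷ as) = trans (cong₂ _+_
        (ones-≡0 (suc (suc b) ∷ as) (λ _ eq → 0≢1+n (sym (suc-injective (List.∷-injectiveˡ eq)))))
        (trans (∑-cong Cs (bumped-suc (suc b) as)) (IH (suc b ∷ as))))
      (𝟙-⇔ (isComposition? n (suc b ∷ as)) (isComposition? (suc n) (suc (suc b) ∷ as))
        (λ { (_ ∷ as-pos , Σ≡) → (s≤s z≤n ∷ as-pos) , cong suc Σ≡ })
        (λ { (_ ∷ as-pos , Σ≡) → (s≤s z≤n ∷ as-pos) , suc-injective Σ≡ }))

module _ {n k : ℕ} (c : Fin n → Fin k) where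

  length-typeOf : length (typeOf c) ≡ k
  length-typeOf = length-map-allFin k _

  typeOf-IsComposition : IsSetComp c → IsComposition n (typeOf c)
  typeOf-IsComposition c-onto = All.tabulate positive , sum≡n
    where
    positive : ∀ {x} → x ∈ typeOf c → 0 < x
    positive x∈ with ∈-map-allFin⁻ k (blockSize c) x∈
    ... | j , refl = blockSize-pos c-onto j
    sum≡n : sum (typeOf c) ≡ n
    sum≡n = begin
      ∑[ j ∈ allFin k ] blockSize c j
        ≡⟨ ∑-cong (allFin k) (λ j → count≡∑𝟙 (λ v → c v Fin.≟ j) (allFin n)) ⟩
      ∑[ j ∈ allFin k ] ∑[ v ∈ allFin n ] 𝟙 (c v Fin.≟ j)
        ≡⟨ ∑-swap (allFin k) (allFin n) _ ⟩
      ∑[ v ∈ allFin n ] ∑[ j ∈ allFin k ] 𝟙 (c v Fin.≟ j)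
        ≡⟨ ∑-cong (allFin n) (λ v → trans (∑-allFin-δ k (c v) _ (λ j j≢cv → 𝟙-no (c v Fin.≟ j) (j≢cv ∘ sym)))
                                          (𝟙-yes (c v Fin.≟ c v) refl)) ⟩
      ∑[ v ∈ allFin n ] 1
        ≡⟨ ∑-const-1 (allFin n) ⟩
      length (allFin n)
        ≡⟨ List.length-tabulate id ⟩
      n ∎
      where open ≡-Reasoning

∈-compositions⇒IsComposition : ∀ {n α} → α ∈ compositions n → IsComposition n α
∈-compositions⇒IsComposition {n} {α} α∈ with isComposition? n α | multiplicity-compositions n α
... | yes α-comp | _ = α-comp
... | no _ | multiplicity≡0 = ⊥-elim (<-irrefl (sym multiplicity≡0) (∈⇒∑𝟙-pos α∈))
  where
  ∈⇒∑𝟙-pos : ∀ {βs} → α ∈ βs → 0 < ∑[ β ∈ βs ] 𝟙 (α ≡L? β)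
  ∈⇒∑𝟙-pos {β ∷ βs} (here refl) rewrite 𝟙-yes (α ≡L? α) refl = s≤s z≤n
  ∈⇒∑𝟙-pos {β ∷ βs} (there α∈βs) = <-≤-trans (∈⇒∑𝟙-pos α∈βs) (m≤n+m _ _)

∑-allFin-toℕ-δ : (n j : ℕ) (H : ℕ → ℕ) → j ≤ n → (∀ i → i ≢ j → H i ≡ 0) → ∑[ K ∈ allFin (suc n) ] H (toℕ K) ≡ H j
∑-allFin-toℕ-δ n j H j≤n H≡0 =
  trans (∑-allFin-δ (suc n) (fromℕ< j<1+n) (H ∘ toℕ)
           (λ K K≢j → H≡0 (toℕ K) (λ K≡j → K≢j (Fin.toℕ-injective (trans K≡j (sym toℕ-j))))))
        (cong H toℕ-j)
  where
  j<1+n : j < suc n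
  j<1+n = s≤s j≤n
  toℕ-j : toℕ (fromℕ< j<1+n) ≡ j
  toℕ-j = Fin.toℕ-fromℕ< j<1+n

module _ {n : ℕ} {PF : ∀ {k} → (Fin n → Fin k) → Set} (PF? : ∀ {k} (c : Fin n → Fin k) → Dec (PF c))
         (PF⇒onto : ∀ {k} (c : Fin n → Fin k) → PF c → IsSetComp c) (u : List ℕ → ℕ) where

  ∑-byType : ∑[ α ∈ compositions n ] (count (λ c → PF? c ×-dec (typeOf c ≡L? α)) (allFuns n (length α)) * u α)
           ≡ ∑[ K ∈ allFin (suc n) ] ∑[ c ∈ allFuns n (toℕ K) ] (𝟙 (PF? c) * u (typeOf c))
  ∑-byType = sym (begin
    ∑[ K ∈ Ks ] ∑[ c ∈ allFuns n (toℕ K) ] (𝟙 (PF? c) * u (typeOf c))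
      ≡⟨ ∑-cong Ks (λ K → ∑-cong (allFuns n (toℕ K)) expand) ⟩
    ∑[ K ∈ Ks ] ∑[ c ∈ allFuns n (toℕ K) ] ∑[ α ∈ Cs ] G c α
      ≡⟨ ∑-cong Ks (λ K → ∑-swap (allFuns n (toℕ K)) Cs _) ⟩
    ∑[ K ∈ Ks ] ∑[ α ∈ Cs ] ∑[ c ∈ allFuns n (toℕ K) ] G c α
      ≡⟨ ∑-swap Ks Cs _ ⟩
    ∑[ α ∈ Cs ] ∑[ K ∈ Ks ] ∑[ c ∈ allFuns n (toℕ K) ] G c α
      ≡⟨ ∑-cong-∈ Cs collapse ⟩
    ∑[ α ∈ Cs ] (count (λ c → PF? c ×-dec (typeOf c ≡L? α)) (allFuns n (length α)) * u α) ∎)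
    where
    open ≡-Reasoning
    Ks : List (Fin (suc n))
    Ks = allFin (suc n)
    Cs : List (List ℕ)
    Cs = compositions n
    G : ∀ {k} → (Fin n → Fin k) → List ℕ → ℕ
    G c α = 𝟙 (PF? c) * (𝟙 (typeOf c ≡L? α) * u α)
    pick : ∀ t → ∑[ α ∈ Cs ] (𝟙 (t ≡L? α) * u α) ≡ 𝟙 (isComposition? n t) * u t
    pick t = trans (∑-cong Cs (λ α → 𝟙-*-cong (t ≡L? α) (λ { refl → refl })))
                   (trans (∑-*ʳ (u t) Cs _) (cong (_* u t) (multiplicity-compositions n t)))
    expand : ∀ {k} (c : Fin n → Fin k) → 𝟙 (PF? c) * u (typeOf c) ≡ ∑[ α ∈ Cs ] G c α
    expand c = sym (trans (∑-*ˡ (𝟙 (PF? c)) Cs _) (𝟙-*-cong (PF? c) λ pc →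
      trans (pick (typeOf c)) (trans (cong (_* u (typeOf c)) (𝟙-yes (isComposition? n (typeOf c)) (typeOf-IsComposition c (PF⇒onto c pc))))
                                     (+-identityʳ _))))
    collapse : ∀ α → α ∈ Cs → ∑[ K ∈ Ks ] ∑[ c ∈ allFuns n (toℕ K) ] G c α
                            ≡ count (λ c → PF? c ×-dec (typeOf c ≡L? α)) (allFuns n (length α)) * u α
    collapse α α∈ = begin
      ∑[ K ∈ Ks ] ∑[ c ∈ allFuns n (toℕ K) ] G c α
        ≡⟨ ∑-allFin-toℕ-δ n (length α) (λ j → ∑[ c ∈ allFuns n j ] G c α)
             (IsComposition⇒length≤ n α (∈-compositions⇒IsComposition α∈)) other-lengths ⟩
      ∑[ c ∈ allFuns n (length α) ] G c α
        ≡⟨ ∑-cong (allFuns n (length α)) (λ c →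
             trans (sym (*-assoc (𝟙 (PF? c)) _ (u α))) (cong (_* u α) (sym (𝟙-× (PF? c) (typeOf c ≡L? α))))) ⟩
      ∑[ c ∈ allFuns n (length α) ] (𝟙 (PF? c ×-dec (typeOf c ≡L? α)) * u α)
        ≡⟨ ∑-*ʳ (u α) (allFuns n (length α)) _ ⟩
      ∑[ c ∈ allFuns n (length α) ] 𝟙 (PF? c ×-dec (typeOf c ≡L? α)) * u α
        ≡⟨ cong (_* u α) (count≡∑𝟙 _ (allFuns n (length α))) ⟨
      count (λ c → PF? c ×-dec (typeOf c ≡L? α)) (allFuns n (length α)) * u α ∎
      where
      other-lengths : ∀ j → j ≢ length α → ∑[ c ∈ allFuns n j ] G c α ≡ 0
      other-lengths j j≢ = ∑-zero (allFuns n j) _ (λ c → trans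
        (cong (λ t → 𝟙 (PF? c) * (t * u α))
              (𝟙-no (typeOf c ≡L? α) (λ type≡α → j≢ (trans (sym (length-typeOf c)) (cong length type≡α)))))
        (*-zeroʳ (𝟙 (PF? c))))

module _ (HM : LinHopfMonoid) (χ : LinCharacter HM) {n : ℕ} (x : LinHopfMonoid.H HM (Fin n)) (σ : Perm n) where

  properFixedColoring? : (f : Fin n → ℕ) → Dec (ProperColoring HM χ x f × FixedF σ f)
  properFixedColoring? f = properColoring? HM χ x f ×-dec fixedF? σ f

  𝟙-properFixedColoring : ∀ {k} {c : Fin n → Fin k} → IsSetComp c → (h : Fin k → ℕ) → h Preserves _<ᶠ_ ⟶ _<_ →
    (g : Fin n → ℕ) → (∀ v → g v ≡ h (c v)) → 𝟙 (properFixedColoring? g) ≡ 𝟙 (properC? HM χ x c ×-dec fixedC? σ c)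
  𝟙-properFixedColoring {c = c} c-onto h h-mono g g≗h∘c = 𝟙-⇔ (properFixedColoring? g) (properC? HM χ x c ×-dec fixedC? σ c)
    (λ (proper , fixed) → trans (sym (phiC-coloring HM χ x)) proper , Equivalence.to (FixedF⇔FixedC σ) fixed)
    (λ (proper , fixed) → trans (phiC-coloring HM χ x) proper , Equivalence.from (FixedF⇔FixedC σ) fixed)
    where open ColoringThrough c c-onto h h-mono g g≗h∘c

  ∑-properFixedColorings : ∀ {m} (s : ℕ → ℕ) → s Preserves _<_ ⟶ _<_ →
    (W : (Fin n → Fin m) → ℕ) → (∀ {f f′} → f ≗ f′ → W f ≡ W f′) →
    ∑[ f ∈ allFuns n m ] (𝟙 (properFixedColoring? (s ∘ toℕ ∘ f)) * W f)
    ≡ ∑[ K ∈ allFin (suc n) ] ∑[ c ∈ allFuns n (toℕ K) ]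
        (𝟙 (properFixedC? HM χ x σ c) * ∑[ e ∈ allFuns (toℕ K) m ] (𝟙 (increasing? e) * W (e ∘ c)))
  ∑-properFixedColorings {m} s s-mono W W-ext =
    trans (∑-allFuns-factorise _ (λ c e → 𝟙 (properC? HM χ x c ×-dec fixedC? σ c) * W (e ∘ c))
            (λ {_} {f} {c} {e} c-onto e-mono e∘c≗f →
              cong₂ _*_ (𝟙-properFixedColoring c-onto (s ∘ toℕ ∘ e) (s-mono ∘ e-mono) (s ∘ toℕ ∘ f) (λ v → cong (s ∘ toℕ) (sym (e∘c≗f v))))
                        (W-ext (sym ∘ e∘c≗f))))
          (∑-cong (allFin (suc n)) λ K → ∑-cong (allFuns n (toℕ K)) λ c → pull-out (toℕ K) c)
    where
    pull-out : ∀ k (c : Fin n → Fin k) →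
      𝟙 (isSetComp? c) * ∑[ e ∈ allFuns k m ] (𝟙 (increasing? e) * (𝟙 (properC? HM χ x c ×-dec fixedC? σ c) * W (e ∘ c)))
      ≡ 𝟙 (properFixedC? HM χ x σ c) * ∑[ e ∈ allFuns k m ] (𝟙 (increasing? e) * W (e ∘ c))
    pull-out k c = begin
      𝟙 sc * ∑[ e ∈ allFuns k m ] (𝟙 (increasing? e) * (𝟙 pf * W (e ∘ c)))
        ≡⟨ cong (𝟙 sc *_) (∑-cong (allFuns k m) (λ e → x∙yz≈y∙xz (𝟙 (increasing? e)) (𝟙 pf) (W (e ∘ c)))) ⟩
      𝟙 sc * ∑[ e ∈ allFuns k m ] (𝟙 pf * (𝟙 (increasing? e) * W (e ∘ c)))
        ≡⟨ cong (𝟙 sc *_) (∑-*ˡ (𝟙 pf) (allFuns k m) _) ⟩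
      𝟙 sc * (𝟙 pf * ∑[ e ∈ allFuns k m ] (𝟙 (increasing? e) * W (e ∘ c)))
        ≡⟨ *-assoc (𝟙 sc) (𝟙 pf) _ ⟨
      𝟙 sc * 𝟙 pf * ∑[ e ∈ allFuns k m ] (𝟙 (increasing? e) * W (e ∘ c))
        ≡⟨ cong (_* ∑[ e ∈ allFuns k m ] (𝟙 (increasing? e) * W (e ∘ c))) (𝟙-× sc pf) ⟨
      𝟙 (sc ×-dec pf) * ∑[ e ∈ allFuns k m ] (𝟙 (increasing? e) * W (e ∘ c)) ∎
      where
      open ≡-Reasoning
      sc : Dec (IsSetComp c)
      sc = isSetComp? c
      pf : Dec (ProperC HM χ x c × FixedC σ c)
      pf = properC? HM χ x c ×-dec fixedC? σ c

  PsiCount-byComposition : ∀ y → PsiCount HM χ x σ y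
    ≡ ∑[ K ∈ allFin (suc n) ] ∑[ c ∈ allFuns n (toℕ K) ] (𝟙 (properFixedC? HM χ x σ c) * (y C toℕ K))
  PsiCount-byComposition y = begin
    PsiCount HM χ x σ y
      ≡⟨ count≡∑𝟙 _ (allFuns n y) ⟩
    ∑[ f ∈ allFuns n y ] 𝟙 (properFixedColoring? (suc ∘ toℕ ∘ f))
      ≡⟨ ∑-cong (allFuns n y) (λ f → *-identityʳ _) ⟨
    ∑[ f ∈ allFuns n y ] (𝟙 (properFixedColoring? (suc ∘ toℕ ∘ f)) * 1)
      ≡⟨ ∑-properFixedColorings suc s≤s (λ _ → 1) (λ _ → refl) ⟩
    ∑[ K ∈ allFin (suc n) ] ∑[ c ∈ allFuns n (toℕ K) ] (𝟙 (properFixedC? HM χ x σ c) * ∑[ e ∈ allFuns (toℕ K) y ] (𝟙 (increasing? e) * 1))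
      ≡⟨ ∑-cong (allFin (suc n)) (λ K → ∑-cong (allFuns n (toℕ K)) λ c → cong (𝟙 (properFixedC? HM χ x σ c) *_)
           (trans (∑-cong (allFuns (toℕ K) y) (λ e → *-identityʳ _)) (count-Increasing (toℕ K) y))) ⟩
    ∑[ K ∈ allFin (suc n) ] ∑[ c ∈ allFuns n (toℕ K) ] (𝟙 (properFixedC? HM χ x σ c) * (y C toℕ K)) ∎
    where open ≡-Reasoning

  PsiCoeff-byComposition : ∀ β → PsiCoeff HM χ x σ β
    ≡ ∑[ K ∈ allFin (suc n) ] ∑[ c ∈ allFuns n (toℕ K) ] (𝟙 (properFixedC? HM χ x σ c) * Mcoeff (typeOf c) β)
  PsiCoeff-byComposition β = begin
    PsiCoeff HM χ x σ β
      ≡⟨ count≡∑𝟙 _ (allFuns n (length β)) ⟩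
    ∑[ f ∈ allFuns n (length β) ] 𝟙 (properFixedColoring? (toℕ ∘ f) ×-dec hasContent? β f)
      ≡⟨ ∑-cong (allFuns n (length β)) (λ f → 𝟙-× (properFixedColoring? (toℕ ∘ f)) (hasContent? β f)) ⟩
    ∑[ f ∈ allFuns n (length β) ] (𝟙 (properFixedColoring? (toℕ ∘ f)) * 𝟙 (hasContent? β f))
      ≡⟨ ∑-properFixedColorings id id (𝟙 ∘ hasContent? β)
           (λ {f} {f′} f≗f′ → 𝟙-⇔ (hasContent? β f) (hasContent? β f′) (HasContent-cong β f≗f′) (HasContent-cong β (sym ∘ f≗f′))) ⟩
    ∑[ K ∈ allFin (suc n) ] ∑[ c ∈ allFuns n (toℕ K) ]
      (𝟙 (properFixedC? HM χ x σ c) * ∑[ e ∈ allFuns (toℕ K) (length β) ] (𝟙 (increasing? e) * 𝟙 (hasContent? β (e ∘ c))))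
      ≡⟨ ∑-cong (allFin (suc n)) (λ K → ∑-cong (allFuns n (toℕ K)) λ c →
           𝟙-*-cong (properFixedC? HM χ x σ c) (λ (c-onto , _) → count-content c c-onto β)) ⟩
    ∑[ K ∈ allFin (suc n) ] ∑[ c ∈ allFuns n (toℕ K) ] (𝟙 (properFixedC? HM χ x σ c) * Mcoeff (typeOf c) β) ∎
    where open ≡-Reasoning

  FixedCompSumCoeff-byComposition : ∀ β → FixedCompSumCoeff HM χ x σ β
    ≡ ∑[ K ∈ allFin (suc n) ] ∑[ c ∈ allFuns n (toℕ K) ] (𝟙 (properFixedC? HM χ x σ c) * Mcoeff (typeOf c) β)
  FixedCompSumCoeff-byComposition β =
    ∑-cong (allFin (suc n)) (λ K → ∑-filter (properFixedC? HM χ x σ) (allFuns n (toℕ K)) (λ c → Mcoeff (typeOf c) β))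

  PsiAlpha-byType : ∀ u → ∑[ α ∈ compositions n ] (PsiAlpha HM χ x σ α * u α)
    ≡ ∑[ K ∈ allFin (suc n) ] ∑[ c ∈ allFuns n (toℕ K) ] (𝟙 (properFixedC? HM χ x σ c) * u (typeOf c))
  PsiAlpha-byType = ∑-byType (properFixedC? HM χ x σ) (λ _ → proj₁)

  PsiAlpha-binomial : ∀ y → ∑[ α ∈ compositions n ] (PsiAlpha HM χ x σ α * (y C length α))
    ≡ ∑[ K ∈ allFin (suc n) ] ∑[ c ∈ allFuns n (toℕ K) ] (𝟙 (properFixedC? HM χ x σ c) * (y C toℕ K))
  PsiAlpha-binomial y = trans (PsiAlpha-byType (λ α → y C length α))
    (∑-cong (allFin (suc n)) λ K → ∑-cong (allFuns n (toℕ K)) λ c →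
       cong (λ l → 𝟙 (properFixedC? HM χ x σ c) * (y C l)) (length-typeOf c))

theorem3 : (HM : LinHopfMonoid) (χ : LinCharacter HM) (n : ℕ)
    (h : LinHopfMonoid.H HM (Fin n)) (G : Perm n → Set) →
    IsSubgroup G → (∀ g → G g → InAut HM h g) →
    (∀ g → G g → ∀ (β : List ℕ) →
       PsiCoeff HM χ h g β ≡ FixedCompSumCoeff HM χ h g β)
    × (∀ g → G g → ∀ (β : List ℕ) →
       PsiCoeff HM χ h g β
         ≡ sum (map (λ α → PsiAlpha HM χ h g α * Mcoeff α β) (compositions n)))
    × (∀ g → G g → ∀ (x : ℕ) →
       PsiCount HM χ h g x
         ≡ sum (map (λ α → PsiAlpha HM χ h g α * (x C length α)) (compositions n)))
theorem3 HM χ n h G _ _ =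
    (λ g _ β → trans (PsiCoeff-byComposition HM χ h g β) (sym (FixedCompSumCoeff-byComposition HM χ h g β)))
  , (λ g _ β → trans (PsiCoeff-byComposition HM χ h g β) (sym (PsiAlpha-byType HM χ h g (λ α → Mcoeff α β))))
  , (λ g _ x → trans (PsiCount-byComposition HM χ h g x) (sym (PsiAlpha-binomial HM χ h g x)))
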